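{- Let $n\ge 1$ and consider pairs $\langle c|l\rangle$ where $c=(c_1,\ldots,c_n)\in\mathsf{DComp}_n$ and $l=(l_1,\ldots,l_n)$ is a permutation of $[n]$. For each $a\in[n]$, the map $\psi_a$ (defined in the context) sends such a pair to another such pair, i.e. $\psi_a(\langle c|l\rangle)=\langle c'|l'\rangle$ with $c'\in\mathsf{DComp}_n$ and $l'$ a permutation of $[n]$, and $\psi_a(\psi_a(\langle c|l\rangle))=\langle c|l\rangle$. Moreover, if $c$ has exactly $m$ parts larger than $1$ and $a=l_i$, then: if $c_i\in\mathsf{Dnu}(c)$ then $c'$ has exactly $m-1$ parts larger than $1$; if $c_i\in\mathsf{Do}(c)$ then $c'$ has exactly $m+1$ parts larger than $1$.
   Context: For a sequence $c=(c_1,\ldots,c_l)$ of positive integers and $i\le j$, $f(c;i,j)=\sum_{t=i}^{j}(c_t-2)$. A composition $c=(c_1,\ldots,c_l)$ is dominating if $f(c;1,i)>0$ for all $1\le i\le l$. $\mathsf{DComp}_n$ is the set of dominating compositions of $2n+1$ into exactly $n$ parts. For $c\in\mathsf{DComp}_n$ set $c_{n+1}:=1$; the part $c_i$ ($1\le i\le n$) lies in $\mathsf{Nuo}(c)$ if $c_i>1,c_{i+1}=1$; in $\mathsf{Onu}(c)$ if $c_i=1,c_{i+1}>1$; in $\mathsf{Dnu}(c)$ if $c_i>1,c_{i+1}>1$; in $\mathsf{Do}(c)$ if $c_i=1,c_{i+1}=1$. Anchor point: if $c_i\in\mathsf{Dnu}(c)$, $\mathsf{ap}(c_i)=c_j$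 where $j$ is the smallest index $j>i$ with $f(c;i+1,j)=0$ and $c_{j+1}=1$; if $c_i\in\mathsf{Do}(c)$, $\mathsf{ap}(c_i)=c_j$ where $j$ is the largest index $j<i$ with $f(c;j,i-1)>0$ (these exist). The map $\psi_a$: given $\langle c|l\rangle$, let $i$ be the position with $l_i=a$, and define $\langle c'|l'\rangle=\psi_a(\langle c|l\rangle)$ by: (i) if $c_i\in\mathsf{Dnu}(c)$ with $\mathsf{ap}(c_i)=c_j$: $c'_i=c_i+c_{i+1}-1$, $c'_t=c_{t+1}$ for $i+1\le t\le j-1$, $c'_j=1$, $c'_t=c_t$ otherwise; $l'_t=l_{t+1}$ for $i\le t\le j-1$, $l'_j=l_i$, $l'_t=l_t$ otherwise. (ii) If $c_i\in\mathsf{Do}(c)$ with $\mathsf{ap}(c_i)=c_j$ and $\alpha=f(c;j,i-1)$: $c'_j=\alpha+1$, $c'_{j+1}=c_j-\alpha$, $c'_t=c_{t-1}$ for $j+2\le t\le i$, $c'_t=c_t$ otherwise; $l'_j=l_i$, $l'_t=l_{t-1}$ for $j+1\le t\le i$, $l'_t=l_t$ otherwise. (iii) If $c_i\in\mathsf{Nuo}(c)\cup\mathsf{Onu}(c)$: $\langle c'|l'\rangle=\langle c|l\rangle$. -}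

module Defs where

open import Data.Bool using (Bool; true; false; if_then_else_; _∧_)
open import Data.Nat using (ℕ; zero; suc; _+_; _*_; _∸_; _≤_; _<_; _≡ᵇ_; _≤ᵇ_; _<ᵇ_)
open import Data.Integer as ℤ using (ℤ; +_; ∣_∣)
import Data.Integer.Properties as ℤP
open import Data.Fin using (Fin; toℕ)
open import Data.List as List using (List; upTo)
open import Data.List.Relation.Binary.Permutation.Propositional using (_↭_)
open import Data.Vec as Vec using (Vec; []; _∷_; tabulate; toList)
open import Data.Vec.Relation.Unary.All using (All)
open import Data.Maybe using (Maybe; just; nothing; maybe)
open import Data.Product using (_×_; _,_)
open import Relation.Nullary.Decidable using (⌊_⌋)
open import Relation.Binary.PropositionalEquality using (_≡_)

-- 1-indexed access: at d v t = v_t for 1 ≤ t ≤ length v, and d otherwise.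
at : ∀ {A : Set} {n} → A → Vec A n → ℕ → A
at d [] t = d
at d (x ∷ v) zero = d
at d (x ∷ v) (suc zero) = x
at d (x ∷ v) (suc (suc t)) = at d v (suc t)

-- c_t (1-indexed), with the convention c_{n+1} := 1
cv : ∀ {n} → Vec ℕ n → ℕ → ℕ
cv c t = at 1 c t

lv : ∀ {n} → Vec ℕ n → ℕ → ℕ
lv l t = at 0 l t

range : ℕ → ℕ → List ℕ
range i j = List.map (λ k → i + k) (upTo (suc j ∸ i))

f : ∀ {n} → Vec ℕ n → ℕ → ℕ → ℤ
f c i j = List.foldr ℤ._+_ (+ 0) (List.map (λ t → (+ cv c t) ℤ.- (+ 2)) (range i j))

IsComposition : (n : ℕ) → Vec ℕ n → Set
IsComposition n c = All (λ x → 1 ≤ x) c × Vec.sum c ≡ 2 * n + 1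

Dominating : (n : ℕ) → Vec ℕ n → Set
Dominating n c = ∀ i → 1 ≤ i → i ≤ n → f c 1 i ℤ.> + 0

DComp : (n : ℕ) → Vec ℕ n → Set
DComp n c = IsComposition n c × Dominating n c

IsPerm : (n : ℕ) → Vec ℕ n → Set
IsPerm n l = toList l ↭ List.map suc (upTo n)

IsDnu : ∀ {n} → Vec ℕ n → ℕ → Set
IsDnu c i = 1 < cv c i × 1 < cv c (suc i)

IsDo : ∀ {n} → Vec ℕ n → ℕ → Set
IsDo c i = cv c i ≡ 1 × cv c (suc i) ≡ 1

numBig : ∀ {n} → Vec ℕ n → ℕ
numBig c = Vec.countᵇ (1 <ᵇ_) c

firstIn : (ℕ → Bool) → ℕ → ℕ → Maybe ℕ
firstIn p lo zero = nothing
firstIn p lo (suc len) = if p lo then just lo else firstIn p (suc lo) len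

lastIn : (ℕ → Bool) → ℕ → ℕ → Maybe ℕ
lastIn p lo zero = nothing
lastIn p lo (suc len) = if p (lo + len) then just (lo + len) else lastIn p lo len

between : ℕ → ℕ → ℕ → Bool
between lo t hi = (lo ≤ᵇ t) ∧ (t ≤ᵇ hi)

posOf : ∀ {n} → ℕ → Vec ℕ n → Maybe ℕ
posOf {n} a l = firstIn (λ t → lv l t ≡ᵇ a) 1 n

apDnu : ∀ {n} → Vec ℕ n → ℕ → Maybe ℕ
apDnu {n} c i = firstIn (λ j → ⌊ f c (suc i) j ℤP.≟ + 0 ⌋ ∧ (cv c (suc j) ≡ᵇ 1)) (suc i) (n ∸ i)

apDo : ∀ {n} → Vec ℕ n → ℕ → Maybe ℕ
apDo c i = lastIn (λ j → ⌊ + 0 ℤP.<? f c j (i ∸ 1) ⌋) 1 (i ∸ 1)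

Pair : ℕ → Set
Pair n = Vec ℕ n × Vec ℕ n

build : (n : ℕ) → (ℕ → ℕ) → Vec ℕ n
build n g = tabulate (λ (k : Fin n) → g (suc (toℕ k)))

stepDnu : ∀ {n} → Vec ℕ n → Vec ℕ n → ℕ → ℕ → Pair n
stepDnu {n} c l i j =
  build n (λ t → if t ≡ᵇ i then cv c i + cv c (suc i) ∸ 1
                 else if between (suc i) t (j ∸ 1) then cv c (suc t)
                 else if t ≡ᵇ j then 1
                 else cv c t)
  , build n (λ t → if between i t (j ∸ 1) then lv l (suc t)
                   else if t ≡ᵇ j then lv l i
                   else lv l t)

stepDo : ∀ {n} → Vec ℕ n → Vec ℕ n → ℕ → ℕ → Pair n
stepDo {n} c l i j =
  build n (λ t → if t ≡ᵇ j then α + 1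
                 else if t ≡ᵇ suc j then cv c j ∸ α
                 else if between (suc (suc j)) t i then cv c (t ∸ 1)
                 else cv c t)
  , build n (λ t → if t ≡ᵇ j then lv l i
                   else if between (suc j) t i then lv l (t ∸ 1)
                   else lv l t)
  where α = ∣ f c j (i ∸ 1) ∣

-- ψ_a(⟨c|l⟩)   (falls back to the identity where the paper's data would not exist)
psi : ∀ {n} → ℕ → Pair n → Pair n
psi a (c , l) with posOf a l
... | nothing = c , l
... | just i =
  if (1 <ᵇ cv c i) ∧ (1 <ᵇ cv c (suc i))
    then maybe (stepDnu c l i) (c , l) (apDnu c i)
  else if (cv c i ≡ᵇ 1) ∧ (cv c (suc i) ≡ᵇ 1)
    then maybe (stepDo c l i) (c , l) (apDo c i)
  else (c , l)

{-# OPTIONS --safe #-}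
-- Let h(t) = Σ_{s ≤ t} (c_s - 2) be the height of c after t parts. Then f(c;i,j) = h(j) - h(i-1),
-- c is dominating iff h > 0 on [1,n], and h(n) = 1 because the parts sum to 2n+1. Since every step
-- c_t - 2 is at least -1, after a Dnu part c_i the heights stay ≥ h(i) up to the anchor point j, which
-- exists because h(n) = 1 ≤ h(i); before a Do part c_i they stay ≥ h(i-1) back to the anchor point j,
-- and α = h(i-1) - h(j-1).
-- The Dnu move makes the heights h(t+1) + 1 on [i, j) and keeps the others; the Do move makes them
-- h(i-1) - 1 at j and h(t-1) - 1 on (j, i], all ≥ h(i-1) - 1 = h(i) > 0, and keeps the others. So both
-- moves keep c dominating. After a Dnu move c′_j = c′_{j+1} = 1 and the Do anchor point of j is i, with
-- α = c_i - 1; after a Do move c′_j = α + 1 and c′_{j+1} = c_j - α exceed 1 and the Dnu anchor point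
-- of j is i. Either way the second move undoes the first, so ψ_a is an involution.
-- A Dnu move replaces the parts c_i, c_{i+1} > 1 by c_i + c_{i+1} - 1 > 1 and 1 and otherwise permutes
-- parts and labels, so it keeps the sum and loses one part > 1; its inverse, the Do move, gains one.
module Submission where

open import Defs
open import Data.Bool using (Bool; true; false; if_then_else_; _∧_; T)
open import Data.Bool.Properties using (T-∧)
open import Data.Empty using (⊥-elim)
open import Data.Integer as ℤ using (ℤ; +_; -_; ∣_∣; +<+)
import Data.Integer.Properties as ℤ
open import Data.Integer.Tactic.RingSolver using (solve-∀)
import Data.List as List
open import Data.List.Relation.Binary.Permutation.Propositional
  using (_↭_; ↭-refl; ↭-sym; ↭-trans; prep; swap; ↭⇒↭ₛ)
open import Data.List.Relation.Binary.Permutation.Setoid.Properties using (Unique-resp-↭)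
open import Data.List.Relation.Unary.AllPairs using (_∷_)
open import Data.List.Relation.Unary.Unique.Propositional using (Unique)
open import Data.List.Relation.Unary.Unique.Propositional.Properties using (upTo⁺; map⁺)
open import Data.Maybe using (just; nothing; maybe)
open import Data.Nat
open import Data.Nat.Properties
open import Algebra.Properties.CommutativeSemigroup +-commutativeSemigroup using (x∙yz≈y∙xz; xy∙z≈xz∙y; xy∙z≈zy∙x)
open import Data.Product as Product using (_×_; _,_; proj₁; proj₂; ∃)
open import Data.Sum using (inj₁; inj₂)
open import Data.Vec as Vec using (Vec; []; _∷_; toList)
open import Data.Vec.Properties using (map-id)
open import Data.Vec.Relation.Unary.All using (All; []; _∷_)
open import Data.Vec.Relation.Unary.All.Properties using (toList⁻)
open import Function using (_∘_; id; Equivalence; _⇔_; mk⇔)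
open import Relation.Binary using (tri<; tri≈; tri>)
open import Relation.Binary.PropositionalEquality
open import Relation.Nullary using (¬_; Dec; yes; no)
open import Relation.Nullary.Decidable using (⌊_⌋; dec-true; dec-false; _×-dec_)

private
  variable
    A : Set
    m n : ℕ

m<n⇒m≤n∸1 : m < n → m ≤ n ∸ 1
m<n⇒m≤n∸1 (s≤s m≤n) = m≤n

n∸1<n : 1 ≤ n → n ∸ 1 < n
n∸1<n {suc n} _ = ≤-refl

x-1<x : ∀ x → x ℤ.- + 1 ℤ.< x
x-1<x x = subst (x ℤ.- + 1 ℤ.<_) (ℤ.+-identityʳ x) (ℤ.+-monoʳ-< x ℤ.-<+)

1<m+n∸1 : 1 < m → 1 ≤ n → 1 < m + n ∸ 1
1<m+n∸1 {m} {n} 1<m 1≤n = <-≤-trans 1<m (subst (m ≤_) (sym (+-∸-assoc m 1≤n)) (m≤m+n m (n ∸ 1)))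

+[m∸n]≡+m-+n : n ≤ m → + (m ∸ n) ≡ + m ℤ.- + n
+[m∸n]≡+m-+n {n = n} {m = m} n≤m = trans (sym (ℤ.⊖-≥ n≤m)) (sym (ℤ.m-n≡m⊖n m n))

if-T : ∀ {b} {x y : A} → T b → (if b then x else y) ≡ x
if-T {b = true} _ = refl

if-¬T : ∀ {b} {x y : A} → ¬ T b → (if b then x else y) ≡ y
if-¬T {b = false} _  = refl
if-¬T {b = true}  ¬t = ⊥-elim (¬t _)

≡ᵇ-refl : ∀ t → T (t ≡ᵇ t)
≡ᵇ-refl t = ≡⇒≡ᵇ t t refl

≢⇒¬≡ᵇ : ∀ s t → s ≢ t → ¬ T (s ≡ᵇ t)
≢⇒¬≡ᵇ s t s≢t = s≢t ∘ ≡ᵇ⇒≡ s t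

between-inside : ∀ lo t hi → lo ≤ t → t ≤ hi → T (between lo t hi)
between-inside _ _ _ lo≤t t≤hi = Equivalence.from T-∧ (≤⇒≤ᵇ lo≤t , ≤⇒≤ᵇ t≤hi)

between-below : ∀ lo t hi → t < lo → ¬ T (between lo t hi)
between-below lo t _ t<lo b = <⇒≱ t<lo (≤ᵇ⇒≤ lo t (proj₁ (Equivalence.to T-∧ b)))

between-above : ∀ lo t hi → hi < t → ¬ T (between lo t hi)
between-above lo t hi hi<t b = <⇒≱ hi<t (≤ᵇ⇒≤ t hi (proj₂ (Equivalence.to (T-∧ {lo ≤ᵇ t}) b)))

⌊⌋-true⇒ : {P : Set} (d : Dec P) → ⌊ d ⌋ ≡ true → P
⌊⌋-true⇒ (yes p) _ = p

⌊⌋-false⇒¬ : {P : Set} (d : Dec P) → ⌊ d ⌋ ≡ false → ¬ P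
⌊⌋-false⇒¬ (no ¬p) _ = ¬p

⌊⌋-true : {P : Set} (d : Dec P) → P → ⌊ d ⌋ ≡ true
⌊⌋-true (yes _) _ = refl
⌊⌋-true (no ¬p) p = ⊥-elim (¬p p)

⌊⌋-false : {P : Set} (d : Dec P) → ¬ P → ⌊ d ⌋ ≡ false
⌊⌋-false (yes p) ¬p = ⊥-elim (¬p p)
⌊⌋-false (no _)  _  = refl

at-zero : (d : A) (v : Vec A n) → at d v 0 ≡ d
at-zero d []      = refl
at-zero d (x ∷ v) = refl

at-beyond : (d : A) (v : Vec A n) (t : ℕ) → n < t → at d v t ≡ d
at-beyond d []      t             _         = refl
at-beyond d (x ∷ v) (suc (suc t)) (s≤s n<t) = at-beyond d v (suc t) n<t

at-build : ∀ d n (g : ℕ → ℕ) t → 1 ≤ t → t ≤ n → at d (build n g) t ≡ g t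
at-build d (suc n) g 1             _ _         = refl
at-build d (suc n) g (suc (suc t)) _ (s≤s t≤n) = at-build d n (g ∘ suc) (suc t) (s≤s z≤n) t≤n

at-ext : (d : A) (v w : Vec A n) → (∀ t → 1 ≤ t → t ≤ n → at d v t ≡ at d w t) → v ≡ w
at-ext d []      []      _  = refl
at-ext d (x ∷ v) (y ∷ w) eq = cong₂ _∷_ (eq 1 ≤-refl (s≤s z≤n))
  (at-ext d v w λ { (suc t) _ t≤n → eq (suc (suc t)) (s≤s z≤n) (s≤s t≤n) })

All⇒at : {P : A → Set} (d : A) (v : Vec A n) → All P v → ∀ t → 1 ≤ t → t ≤ n → P (at d v t)
All⇒at d (x ∷ v) (px ∷ _)   1             _ _         = px
All⇒at d (x ∷ v) (_  ∷ pxs) (suc (suc t)) _ (s≤s t≤n) = All⇒at d v pxs (suc t) (s≤s z≤n) t≤n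

at⇒All : {P : A → Set} (d : A) (v : Vec A n) → (∀ t → 1 ≤ t → t ≤ n → P (at d v t)) → All P v
at⇒All d []      _  = []
at⇒All d (x ∷ v) pv = pv 1 ≤-refl (s≤s z≤n)
  ∷ at⇒All d v λ { (suc t) _ t≤n → pv (suc (suc t)) (s≤s z≤n) (s≤s t≤n) }

at-injective : (d : A) (v : Vec A n) → Unique (toList v) →
  ∀ s t → 1 ≤ s → s ≤ n → 1 ≤ t → t ≤ n → at d v s ≡ at d v t → s ≡ t
at-injective d (x ∷ v) _        1             1             _ _         _ _         _  = refl
at-injective d (x ∷ v) (x∉ ∷ _) 1             (suc (suc t)) _ _         _ (s≤s t≤n) eq =
  ⊥-elim (All⇒at d v (toList⁻ x∉) (suc t) (s≤s z≤n) t≤n eq)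
at-injective d (x ∷ v) (x∉ ∷ _) (suc (suc s)) 1             _ (s≤s s≤n) _ _         eq =
  ⊥-elim (All⇒at d v (toList⁻ x∉) (suc s) (s≤s z≤n) s≤n (sym eq))
at-injective d (x ∷ v) (_ ∷ u)  (suc (suc s)) (suc (suc t)) _ (s≤s s≤n) _ (s≤s t≤n) eq =
  cong suc (at-injective d v u (suc s) (suc t) (s≤s z≤n) s≤n (s≤s z≤n) t≤n eq)

sumMap : (ℕ → ℕ) → Vec ℕ n → ℕ
sumMap h v = Vec.sum (Vec.map h v)

swapAt : Vec A n → ℕ → Vec A n
swapAt []          _             = []
swapAt (x ∷ v)     zero          = x ∷ v
swapAt (x ∷ v)     (suc (suc k)) = x ∷ swapAt v (suc k)
swapAt (x ∷ [])    1             = x ∷ []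
swapAt (x ∷ y ∷ v) 1             = y ∷ x ∷ v

swapAt-↭ : (v : Vec A n) (k : ℕ) → toList (swapAt v k) ↭ toList v
swapAt-↭ []          _             = ↭-refl
swapAt-↭ (x ∷ v)     zero          = ↭-refl
swapAt-↭ (x ∷ [])    1             = ↭-refl
swapAt-↭ (x ∷ y ∷ v) 1             = swap y x ↭-refl
swapAt-↭ (x ∷ v)     (suc (suc k)) = prep x (swapAt-↭ v (suc k))

sumMap-swapAt : (h : ℕ → ℕ) (v : Vec ℕ n) (k : ℕ) →
  sumMap h (swapAt v k) ≡ sumMap h v
sumMap-swapAt h []          _             = refl
sumMap-swapAt h (x ∷ v)     zero          = refl
sumMap-swapAt h (x ∷ [])    1             = refl
sumMap-swapAt h (x ∷ y ∷ v) 1             = x∙yz≈y∙xz (h y) (h x) _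
sumMap-swapAt h (x ∷ v)     (suc (suc k)) = cong (λ s → h x + s) (sumMap-swapAt h v (suc k))

at-swapAt-left : (d : A) (v : Vec A n) (k : ℕ) → 1 ≤ k → suc k ≤ n → at d (swapAt v k) k ≡ at d v (suc k)
at-swapAt-left d (x ∷ y ∷ v) 1             _ _         = refl
at-swapAt-left d (x ∷ v)     (suc (suc k)) _ (s≤s k<n) = at-swapAt-left d v (suc k) (s≤s z≤n) k<n

at-swapAt-right : (d : A) (v : Vec A n) (k : ℕ) → 1 ≤ k → suc k ≤ n → at d (swapAt v k) (suc k) ≡ at d v k
at-swapAt-right d (x ∷ y ∷ v) 1             _ _         = refl
at-swapAt-right d (x ∷ v)     (suc (suc k)) _ (s≤s k<n) = at-swapAt-right d v (suc k) (s≤s z≤n) k<n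

at-swapAt-other : (d : A) (v : Vec A n) (k t : ℕ) → t ≢ k → t ≢ suc k → at d (swapAt v k) t ≡ at d v t
at-swapAt-other d []          _             _                   _   _   = refl
at-swapAt-other d (x ∷ v)     zero          _                   _   _   = refl
at-swapAt-other d (x ∷ [])    1             _                   _   _   = refl
at-swapAt-other d (x ∷ y ∷ v) 1             zero                _   _   = refl
at-swapAt-other d (x ∷ y ∷ v) 1             1                   t≢k _   = ⊥-elim (t≢k refl)
at-swapAt-other d (x ∷ y ∷ v) 1             2                   _   t≢k = ⊥-elim (t≢k refl)
at-swapAt-other d (x ∷ y ∷ v) 1             (suc (suc (suc t))) _   _   = refl
at-swapAt-other d (x ∷ v)     (suc (suc k)) zero                _   _   = refl
at-swapAt-other d (x ∷ v)     (suc (suc k)) 1                   _   _   = refl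
at-swapAt-other d (x ∷ v)     (suc (suc k)) (suc (suc t))       t≢k t≢k+1 =
  at-swapAt-other d v (suc k) (suc t) (t≢k ∘ cong suc) (t≢k+1 ∘ cong suc)

setAt : Vec A n → ℕ → A → Vec A n
setAt []      _             _ = []
setAt (y ∷ v) zero          _ = y ∷ v
setAt (y ∷ v) 1             z = z ∷ v
setAt (y ∷ v) (suc (suc k)) z = y ∷ setAt v (suc k) z

at-setAt-same : (d : A) (v : Vec A n) (k : ℕ) (z : A) → 1 ≤ k → k ≤ n → at d (setAt v k z) k ≡ z
at-setAt-same d (y ∷ v) 1             z _ _         = refl
at-setAt-same d (y ∷ v) (suc (suc k)) z _ (s≤s k≤n) = at-setAt-same d v (suc k) z (s≤s z≤n) k≤n

at-setAt-other : (d : A) (v : Vec A n) (k : ℕ) (z : A) (t : ℕ) → t ≢ k → at d (setAt v k z) t ≡ at d v t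
at-setAt-other d []      _             _ _             _   = refl
at-setAt-other d (y ∷ v) zero          _ _             _   = refl
at-setAt-other d (y ∷ v) 1             _ zero          _   = refl
at-setAt-other d (y ∷ v) 1             _ 1             t≢k = ⊥-elim (t≢k refl)
at-setAt-other d (y ∷ v) 1             _ (suc (suc t)) _   = refl
at-setAt-other d (y ∷ v) (suc (suc k)) _ zero          _   = refl
at-setAt-other d (y ∷ v) (suc (suc k)) _ 1             _   = refl
at-setAt-other d (y ∷ v) (suc (suc k)) z (suc (suc t)) t≢k = at-setAt-other d v (suc k) z (suc t) (t≢k ∘ cong suc)

sumMap-setAt : (h : ℕ → ℕ) (v : Vec ℕ n) (k z : ℕ) → 1 ≤ k → k ≤ n →
  sumMap h (setAt v k z) + h (at 1 v k) ≡ sumMap h v + h z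
sumMap-setAt h (y ∷ v) 1             z _ _         = xy∙z≈zy∙x (h z) (sumMap h v) (h y)
sumMap-setAt h (y ∷ v) (suc (suc k)) z _ (s≤s k≤n) = begin
  h y + sumMap h (setAt v (suc k) z) + h (at 1 v (suc k))
    ≡⟨ +-assoc (h y) _ _ ⟩
  h y + (sumMap h (setAt v (suc k) z) + h (at 1 v (suc k)))
    ≡⟨ cong (λ s → h y + s) (sumMap-setAt h v (suc k) z (s≤s z≤n) k≤n) ⟩
  h y + (sumMap h v + h z)
    ≡⟨ +-assoc (h y) _ _ ⟨
  h y + sumMap h v + h z ∎
  where open ≡-Reasoning

-- moves the entry at p to p + k, shifting the entries in between one step left
moveRight : Vec A n → ℕ → ℕ → Vec A n
moveRight v p zero    = v
moveRight v p (suc k) = moveRight (swapAt v p) (suc p) k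

moveRight-↭ : (v : Vec A n) (p k : ℕ) → toList (moveRight v p k) ↭ toList v
moveRight-↭ v p zero    = ↭-refl
moveRight-↭ v p (suc k) = ↭-trans (moveRight-↭ (swapAt v p) (suc p) k) (swapAt-↭ v p)

sumMap-moveRight : (h : ℕ → ℕ) (v : Vec ℕ n) (p k : ℕ) →
  sumMap h (moveRight v p k) ≡ sumMap h v
sumMap-moveRight h v p zero    = refl
sumMap-moveRight h v p (suc k) = trans (sumMap-moveRight h (swapAt v p) (suc p) k) (sumMap-swapAt h v p)

at-moveRight-below : (d : A) (v : Vec A n) (p k t : ℕ) → 1 ≤ p → p + k ≤ n → t < p →
  at d (moveRight v p k) t ≡ at d v t
at-moveRight-below d v p zero    t _ _     _   = refl
at-moveRight-below {n = n} d v p (suc k) t _ p+k≤n t<p = begin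
  at d (moveRight (swapAt v p) (suc p) k) t
    ≡⟨ at-moveRight-below d (swapAt v p) (suc p) k t (s≤s z≤n) (subst (_≤ n) (+-suc p k) p+k≤n) (m<n⇒m<1+n t<p) ⟩
  at d (swapAt v p) t
    ≡⟨ at-swapAt-other d v p t (<⇒≢ t<p) (<⇒≢ (m<n⇒m<1+n t<p)) ⟩
  at d v t ∎
  where open ≡-Reasoning

at-moveRight-above : (d : A) (v : Vec A n) (p k t : ℕ) → 1 ≤ p → p + k ≤ n → p + k < t →
  at d (moveRight v p k) t ≡ at d v t
at-moveRight-above d v p zero    t _ _     _     = refl
at-moveRight-above {n = n} d v p (suc k) t _ p+k≤n p+k<t = begin
  at d (moveRight (swapAt v p) (suc p) k) t
    ≡⟨ at-moveRight-above d (swapAt v p) (suc p) k t (s≤s z≤n) (subst (_≤ n) (+-suc p k) p+k≤n) (subst (_< t) (+-suc p k) p+k<t) ⟩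
  at d (swapAt v p) t
    ≡⟨ at-swapAt-other d v p t (>⇒≢ (<-trans (n<1+n p) p+1<t)) (>⇒≢ p+1<t) ⟩
  at d v t ∎
  where
  open ≡-Reasoning
  p+1<t : suc p < t
  p+1<t = ≤-<-trans (subst (suc p ≤_) (sym (+-suc p k)) (m≤m+n (suc p) k)) p+k<t

at-moveRight-target : (d : A) (v : Vec A n) (p k : ℕ) → 1 ≤ p → p + k ≤ n →
  at d (moveRight v p k) (p + k) ≡ at d v p
at-moveRight-target d v p zero    _ _ rewrite +-identityʳ p = refl
at-moveRight-target {n = n} d v p (suc k) 1≤p p+k≤n = begin
  at d (moveRight (swapAt v p) (suc p) k) (p + suc k)
    ≡⟨ cong (at d (moveRight (swapAt v p) (suc p) k)) (+-suc p k) ⟩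
  at d (moveRight (swapAt v p) (suc p) k) (suc p + k)
    ≡⟨ at-moveRight-target d (swapAt v p) (suc p) k (s≤s z≤n) p+1+k≤n ⟩
  at d (swapAt v p) (suc p)
    ≡⟨ at-swapAt-right d v p 1≤p (≤-trans (m≤m+n (suc p) k) p+1+k≤n) ⟩
  at d v p ∎
  where
  open ≡-Reasoning
  p+1+k≤n : suc p + k ≤ n
  p+1+k≤n = subst (_≤ n) (+-suc p k) p+k≤n

at-moveRight-between : (d : A) (v : Vec A n) (p k t : ℕ) → 1 ≤ p → p + k ≤ n → p ≤ t → t < p + k →
  at d (moveRight v p k) t ≡ at d v (suc t)
at-moveRight-between d v p zero    t _   _     p≤t t<p = ⊥-elim (<⇒≱ t<p (subst (_≤ t) (sym (+-identityʳ p)) p≤t))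
at-moveRight-between {n = n} d v p (suc k) t 1≤p p+k≤n p≤t t<p+k with m≤n⇒m<n∨m≡n p≤t
... | inj₂ refl = begin
  at d (moveRight (swapAt v t) (suc t) k) t
    ≡⟨ at-moveRight-below d (swapAt v t) (suc t) k t (s≤s z≤n) p+1+k≤n (n<1+n t) ⟩
  at d (swapAt v t) t                       ≡⟨ at-swapAt-left d v t 1≤p (≤-trans (m≤m+n (suc t) k) p+1+k≤n) ⟩
  at d v (suc t)                            ∎
  where
  open ≡-Reasoning
  p+1+k≤n : suc p + k ≤ n
  p+1+k≤n = subst (_≤ n) (+-suc p k) p+k≤n
... | inj₁ p<t = begin
  at d (moveRight (swapAt v p) (suc p) k) t
    ≡⟨ at-moveRight-between d (swapAt v p) (suc p) k t (s≤s z≤n) (subst (_≤ n) (+-suc p k) p+k≤n) p<t (subst (t <_) (+-suc p k) t<p+k) ⟩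
  at d (swapAt v p) (suc t)
    ≡⟨ at-swapAt-other d v p (suc t) (>⇒≢ (m<n⇒m<1+n p<t)) (>⇒≢ (s≤s p<t)) ⟩
  at d v (suc t) ∎
  where open ≡-Reasoning

IsFirstIn : (ℕ → Bool) → ℕ → ℕ → ℕ → Set
IsFirstIn p lo len k = lo ≤ k × k < lo + len × p k ≡ true × (∀ t → lo ≤ t → t < k → p t ≡ false)

IsLastIn : (ℕ → Bool) → ℕ → ℕ → ℕ → Set
IsLastIn p lo len k = lo ≤ k × k < lo + len × p k ≡ true × (∀ t → k < t → t < lo + len → p t ≡ false)

firstIn-just : ∀ p lo len k → firstIn p lo len ≡ just k → IsFirstIn p lo len k
firstIn-just p lo (suc len) k eq with p lo in plo
... | true with refl ← eq =
  ≤-refl , subst (k <_) (sym (+-suc k len)) (s≤s (m≤m+n k len)) , plo , λ t k≤t t<k → ⊥-elim (<⇒≱ t<k k≤t)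
... | false with firstIn-just p (suc lo) len k eq
... | lo<k , k<end , pk , before = <⇒≤ lo<k , subst (k <_) (sym (+-suc lo len)) k<end , pk , before′
  where
  before′ : ∀ t → lo ≤ t → t < k → p t ≡ false
  before′ t lo≤t t<k with m≤n⇒m<n∨m≡n lo≤t
  ... | inj₁ lo<t = before t lo<t t<k
  ... | inj₂ refl = plo

firstIn-nothing : ∀ p lo len → firstIn p lo len ≡ nothing → ∀ t → lo ≤ t → t < lo + len → p t ≡ false
firstIn-nothing p lo zero      _  t lo≤t t<lo = ⊥-elim (<⇒≱ t<lo (subst (_≤ t) (sym (+-identityʳ lo)) lo≤t))
firstIn-nothing p lo (suc len) eq t lo≤t t<end with p lo in plo | m≤n⇒m<n∨m≡n lo≤t
... | false | inj₂ refl = plo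
... | false | inj₁ lo<t = firstIn-nothing p (suc lo) len eq t lo<t (subst (t <_) (+-suc lo len) t<end)

firstIn-complete : ∀ p lo len k → IsFirstIn p lo len k → firstIn p lo len ≡ just k
firstIn-complete p lo zero      k (lo≤k , k<lo , _) = ⊥-elim (<⇒≱ k<lo (subst (_≤ k) (sym (+-identityʳ lo)) lo≤k))
firstIn-complete p lo (suc len) k (lo≤k , k<end , pk , before) with m≤n⇒m<n∨m≡n lo≤k
... | inj₂ refl rewrite pk = refl
... | inj₁ lo<k rewrite before lo ≤-refl lo<k =
  firstIn-complete p (suc lo) len k (lo<k , subst (k <_) (+-suc lo len) k<end , pk , λ t lo<t → before t (<⇒≤ lo<t))

lastIn-just : ∀ p lo len k → lastIn p lo len ≡ just k → IsLastIn p lo len k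
lastIn-just p lo (suc len) k eq with p (lo + len) in ptop
... | true with refl ← eq =
  m≤m+n lo len , subst (lo + len <_) (sym (+-suc lo len)) ≤-refl , ptop ,
  λ t k<t t<end → ⊥-elim (<⇒≱ k<t (≤-pred (subst (t <_) (+-suc lo len) t<end)))
... | false with lastIn-just p lo len k eq
... | lo≤k , k<end , pk , after = lo≤k , subst (k <_) (sym (+-suc lo len)) (m<n⇒m<1+n k<end) , pk , after′
  where
  after′ : ∀ t → k < t → t < lo + suc len → p t ≡ false
  after′ t k<t t<end with m≤n⇒m<n∨m≡n (≤-pred (subst (t <_) (+-suc lo len) t<end))
  ... | inj₁ t<top = after t k<t t<top
  ... | inj₂ refl  = ptop

lastIn-nothing : ∀ p lo len → lastIn p lo len ≡ nothing → ∀ t → lo ≤ t → t < lo + len → p t ≡ false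
lastIn-nothing p lo zero      _  t lo≤t t<lo = ⊥-elim (<⇒≱ t<lo (subst (_≤ t) (sym (+-identityʳ lo)) lo≤t))
lastIn-nothing p lo (suc len) eq t lo≤t t<end
  with p (lo + len) in ptop | m≤n⇒m<n∨m≡n (≤-pred (subst (t <_) (+-suc lo len) t<end))
... | false | inj₂ refl  = ptop
... | false | inj₁ t<top = lastIn-nothing p lo len eq t lo≤t t<top

lastIn-complete : ∀ p lo len k → IsLastIn p lo len k → lastIn p lo len ≡ just k
lastIn-complete p lo zero      k (lo≤k , k<lo , _) = ⊥-elim (<⇒≱ k<lo (subst (_≤ k) (sym (+-identityʳ lo)) lo≤k))
lastIn-complete p lo (suc len) k (lo≤k , k<end , pk , after) with m≤n⇒m<n∨m≡n (≤-pred (subst (k <_) (+-suc lo len) k<end))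
... | inj₂ refl rewrite pk = refl
... | inj₁ k<top rewrite after (lo + len) k<top (subst (lo + len <_) (sym (+-suc lo len)) ≤-refl) =
  lastIn-complete p lo len k (lo≤k , k<top , pk , λ t k<t t<top → after t k<t (subst (t <_) (sym (+-suc lo len)) (m<n⇒m<1+n t<top)))

IsPosOf : ℕ → Vec ℕ n → ℕ → Set
IsPosOf {n} a l i = 1 ≤ i × i ≤ n × lv l i ≡ a × (∀ t → 1 ≤ t → t < i → lv l t ≢ a)

module _ (a : ℕ) (l : Vec ℕ n) where

  posOf-just : ∀ {i} → posOf a l ≡ just i → IsPosOf a l i
  posOf-just {i} eq with firstIn-just _ 1 n i eq
  ... | 1≤i , i<1+n , hit , before = 1≤i , ≤-pred i<1+n , ≡ᵇ⇒≡ _ _ (subst T (sym hit) _) ,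
    λ t 1≤t t<i lt≡a → subst T (before t 1≤t t<i) (≡⇒≡ᵇ _ _ lt≡a)

  posOf-complete : ∀ {i} → IsPosOf a l i → posOf a l ≡ just i
  posOf-complete {i} (1≤i , i≤n , li≡a , before) = firstIn-complete _ 1 n i
    (1≤i , s≤s i≤n , dec-true (lv l i ≟ a) li≡a , λ t 1≤t t<i → dec-false (lv l t ≟ a) (before t 1≤t t<i))

  posOf-nothing : posOf a l ≡ nothing → ∀ t → 1 ≤ t → t ≤ n → lv l t ≢ a
  posOf-nothing eq t 1≤t t≤n lt≡a = subst T (firstIn-nothing _ 1 n eq t 1≤t (s≤s t≤n)) (≡⇒≡ᵇ _ _ lt≡a)

LabelsDistinct : (n : ℕ) → Vec ℕ n → Set
LabelsDistinct n l = ∀ s t → 1 ≤ s → s ≤ n → 1 ≤ t → t ≤ n → lv l s ≡ lv l t → s ≡ t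

IsPerm⇒LabelsDistinct : (l : Vec ℕ n) → IsPerm n l → LabelsDistinct n l
IsPerm⇒LabelsDistinct {n} l perm = at-injective 0 l (Unique-resp-↭ (setoid ℕ) (↭⇒↭ₛ (↭-sym perm)) (map⁺ suc-injective (upTo⁺ n)))

-- Heights: the paper's f(c;i,j) is a difference of prefix sums

step : Vec ℕ n → ℕ → ℤ
step c t = + cv c t ℤ.- + 2

height : Vec ℕ n → ℕ → ℤ
height c zero    = + 0
height c (suc t) = height c t ℤ.+ step c (suc t)

height-pred : (c : Vec ℕ n) (t : ℕ) → 1 ≤ t → height c t ≡ height c (t ∸ 1) ℤ.+ step c t
height-pred c (suc t) _ = refl

f-telescope : (c : Vec ℕ n) (p q k : ℕ) (h : ℕ → ℕ) → (∀ s → h s ≡ q + s) →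
  List.foldr ℤ._+_ (+ 0) (List.map (step c) (List.map (λ s → suc p + s) (List.applyUpTo h k)))
    ≡ height c (p + q + k) ℤ.- height c (p + q)
f-telescope c p q zero      h _     rewrite +-identityʳ (p + q) = sym (ℤ.+-inverseʳ (height c (p + q)))
f-telescope c p q (suc k) h h≡q+ = begin
  step c (suc p + h 0) ℤ.+ List.foldr ℤ._+_ (+ 0) (List.map (step c) (List.map (λ s → suc p + s) (List.applyUpTo (h ∘ suc) k)))
    ≡⟨ cong₂ ℤ._+_ (cong (λ z → step c (suc p + z)) (trans (h≡q+ 0) (+-identityʳ q)))
                   (f-telescope c p (suc q) k (h ∘ suc) λ s → trans (h≡q+ (suc s)) (+-suc q s)) ⟩
  step c (suc (p + q)) ℤ.+ (height c (p + suc q + k) ℤ.- height c (p + suc q))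
    ≡⟨ cong (λ z → step c (suc (p + q)) ℤ.+ (height c (z + k) ℤ.- height c z)) (+-suc p q) ⟩
  step c (suc (p + q)) ℤ.+ (height c (suc (p + q) + k) ℤ.- (height c (p + q) ℤ.+ step c (suc (p + q))))
    ≡⟨ telescope (step c (suc (p + q))) (height c (suc (p + q) + k)) (height c (p + q)) ⟩
  height c (suc (p + q) + k) ℤ.- height c (p + q)
    ≡⟨ cong (λ z → height c z ℤ.- height c (p + q)) (+-suc (p + q) k) ⟨
  height c (p + q + suc k) ℤ.- height c (p + q) ∎
  where
  open ≡-Reasoning
  telescope : ∀ (g x y : ℤ) → g ℤ.+ (x ℤ.- (y ℤ.+ g)) ≡ x ℤ.- y
  telescope = solve-∀

f≡height-diff : (c : Vec ℕ n) (p j : ℕ) → p ≤ j → f c (suc p) j ≡ height c j ℤ.- height c p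
f≡height-diff c p j p≤j = begin
  f c (suc p) j                                  ≡⟨ f-telescope c p 0 (j ∸ p) id (λ _ → refl) ⟩
  height c (p + 0 + (j ∸ p)) ℤ.- height c (p + 0)
    ≡⟨ cong (λ z → height c (z + (j ∸ p)) ℤ.- height c z) (+-identityʳ p) ⟩
  height c (p + (j ∸ p)) ℤ.- height c p           ≡⟨ cong (λ z → height c z ℤ.- height c p) (m+[n∸m]≡n p≤j) ⟩
  height c j ℤ.- height c p                       ∎
  where open ≡-Reasoning

f-from≡height-diff : (c : Vec ℕ n) (s j : ℕ) → 1 ≤ s → s ∸ 1 ≤ j → f c s j ≡ height c j ℤ.- height c (s ∸ 1)
f-from≡height-diff c (suc p) j _ p≤j = f≡height-diff c p j p≤j

f-from-1≡height : (c : Vec ℕ n) (j : ℕ) → f c 1 j ≡ height c j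
f-from-1≡height c j = trans (f≡height-diff c 0 j z≤n) (ℤ.+-identityʳ (height c j))

height-shift : (c : Vec ℕ m) (c′ : Vec ℕ n) (a b : ℕ) (e : ℤ) (k : ℕ) → height c′ a ≡ height c b ℤ.+ e →
  (∀ s → 1 ≤ s → s ≤ k → cv c′ (a + s) ≡ cv c (b + s)) → height c′ (a + k) ≡ height c (b + k) ℤ.+ e
height-shift c c′ a b e zero    start _ rewrite +-identityʳ a | +-identityʳ b = start
height-shift c c′ a b e (suc k) start same rewrite +-suc a k | +-suc b k = begin
  height c′ (a + k) ℤ.+ step c′ (suc (a + k))
    ≡⟨ cong₂ ℤ._+_ (height-shift c c′ a b e k start λ s 1≤s s≤k → same s 1≤s (m≤n⇒m≤1+n s≤k))
                   (cong (λ z → + z ℤ.- + 2) same-last) ⟩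
  height c (b + k) ℤ.+ e ℤ.+ step c (suc (b + k))
    ≡⟨ swap-last (height c (b + k)) e (step c (suc (b + k))) ⟩
  height c (b + k) ℤ.+ step c (suc (b + k)) ℤ.+ e ∎
  where
  open ≡-Reasoning
  same-last : cv c′ (suc (a + k)) ≡ cv c (suc (b + k))
  same-last = trans (cong (cv c′) (sym (+-suc a k))) (trans (same (suc k) (s≤s z≤n) ≤-refl) (cong (cv c) (+-suc b k)))
  swap-last : ∀ (x e g : ℤ) → x ℤ.+ e ℤ.+ g ≡ x ℤ.+ g ℤ.+ e
  swap-last = solve-∀

height-cons : ∀ x (v : Vec ℕ n) t → height (x ∷ v) (suc t) ≡ (+ x ℤ.- + 2) ℤ.+ height v t
height-cons x v zero    = ℤ.+-comm (+ 0) (+ x ℤ.- + 2)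
height-cons x v (suc t) = trans (cong (ℤ._+ step v (suc t)) (height-cons x v t))
                                (ℤ.+-assoc (+ x ℤ.- + 2) (height v t) (step v (suc t)))

height-last : (v : Vec ℕ n) → height v n ≡ + Vec.sum v ℤ.- + (2 * n)
height-last []                = refl
height-last {suc n} (x ∷ v) = begin
  height (x ∷ v) (suc n)                                  ≡⟨ height-cons x v n ⟩
  (+ x ℤ.- + 2) ℤ.+ height v n
    ≡⟨ cong (λ z → (+ x ℤ.- + 2) ℤ.+ z) (height-last v) ⟩
  (+ x ℤ.- + 2) ℤ.+ (+ Vec.sum v ℤ.- + (2 * n))           ≡⟨ regroup (+ x) (+ Vec.sum v) (+ (2 * n)) ⟩
  (+ x ℤ.+ + Vec.sum v) ℤ.- (+ 2 ℤ.+ + (2 * n))           ≡⟨ cong₂ ℤ._-_ (ℤ.pos-+ x (Vec.sum v))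
                                                               (trans (ℤ.pos-+ 2 (2 * n)) (cong +_ (sym (*-distribˡ-+ 2 1 n)))) ⟩
  + (x + Vec.sum v) ℤ.- + (2 * suc n)                     ∎
  where
  open ≡-Reasoning
  regroup : ∀ (a b c : ℤ) → (a ℤ.- + 2) ℤ.+ (b ℤ.- c) ≡ (a ℤ.+ b) ℤ.- (+ 2 ℤ.+ c)
  regroup = solve-∀

-- A step c - 2 ≥ -1 can only take a height below a level y if it is a step c = 1 from y itself.
step-stays-above : ∀ {x y : ℤ} c → y ℤ.≤ x → 1 ≤ c → (x ≡ y → c ≢ 1) → y ℤ.≤ x ℤ.+ (+ c ℤ.- + 2)
step-stays-above {x} {y} 1             y≤x _ ok =
  subst (y ℤ.≤_) (ℤ.+-comm (- + 1) x) (ℤ.i<j⇒i≤pred[j] (ℤ.≤∧≢⇒< y≤x λ y≡x → ok (sym y≡x) refl))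
step-stays-above {x} {y} (suc (suc c)) y≤x _ _ = ℤ.≤-trans y≤x (ℤ.i≤i+j x (+ c))

module _ {c : Vec ℕ n} (dc : DComp n c) where

  DComp⇒1≤part : ∀ t → 1 ≤ t → t ≤ n → 1 ≤ cv c t
  DComp⇒1≤part = All⇒at 1 c (proj₁ (proj₁ dc))

  DComp⇒0<height : ∀ t → 1 ≤ t → t ≤ n → + 0 ℤ.< height c t
  DComp⇒0<height t 1≤t t≤n = subst (+ 0 ℤ.<_) (f-from-1≡height c t) (proj₂ dc t 1≤t t≤n)

  DComp⇒height-last≡1 : height c n ≡ + 1
  DComp⇒height-last≡1 = begin
    height c n                       ≡⟨ height-last c ⟩
    + Vec.sum c ℤ.- + (2 * n)         ≡⟨ cong (λ s → + s ℤ.- + (2 * n)) (proj₂ (proj₁ dc)) ⟩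
    + (2 * n + 1) ℤ.- + (2 * n)       ≡⟨ [x+1]-x≡1 (+ (2 * n)) ⟩
    + 1                               ∎
    where
    open ≡-Reasoning
    [x+1]-x≡1 : ∀ (x : ℤ) → (x ℤ.+ + 1) ℤ.- x ≡ + 1
    [x+1]-x≡1 = solve-∀

dnuTest : Vec ℕ n → ℕ → ℕ → Bool
dnuTest c i t = ⌊ f c (suc i) t ℤ.≟ + 0 ⌋ ∧ (cv c (suc t) ≡ᵇ 1)

doTest : Vec ℕ n → ℕ → ℕ → Bool
doTest c i s = ⌊ + 0 ℤ.<? f c s (i ∸ 1) ⌋

module _ {P : Set} where

  ⌊⌋∧≡ᵇ1-true⇒ : (d : Dec P) (x : ℕ) → (⌊ d ⌋ ∧ (x ≡ᵇ 1)) ≡ true → P × x ≡ 1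
  ⌊⌋∧≡ᵇ1-true⇒ (yes p) 1             _  = p , refl
  ⌊⌋∧≡ᵇ1-true⇒ (yes p) 0             ()
  ⌊⌋∧≡ᵇ1-true⇒ (yes p) (suc (suc x)) ()
  ⌊⌋∧≡ᵇ1-true⇒ (no ¬p) x             ()

  ⌊⌋∧≡ᵇ1-false⇒ : (d : Dec P) (x : ℕ) → (⌊ d ⌋ ∧ (x ≡ᵇ 1)) ≡ false → P → x ≢ 1
  ⌊⌋∧≡ᵇ1-false⇒ (yes p) 1 () _ refl
  ⌊⌋∧≡ᵇ1-false⇒ (no ¬p) x _  p = ⊥-elim (¬p p)

  ⌊⌋∧≡ᵇ1-true : (d : Dec P) → P → (⌊ d ⌋ ∧ (1 ≡ᵇ 1)) ≡ true
  ⌊⌋∧≡ᵇ1-true d p rewrite ⌊⌋-true d p = refl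

  ⌊⌋∧≡ᵇ1-false : (d : Dec P) (x : ℕ) → (P → x ≢ 1) → (⌊ d ⌋ ∧ (x ≡ᵇ 1)) ≡ false
  ⌊⌋∧≡ᵇ1-false (no _)  x             _   = refl
  ⌊⌋∧≡ᵇ1-false (yes p) 0             _   = refl
  ⌊⌋∧≡ᵇ1-false (yes p) 1             x≢1 = ⊥-elim (x≢1 p refl)
  ⌊⌋∧≡ᵇ1-false (yes p) (suc (suc x)) _   = refl

module _ (c : Vec ℕ n) {i t : ℕ} (i≤t : i ≤ t) where

  private
    f≡0⇔height≡ : f c (suc i) t ≡ + 0 ⇔ height c t ≡ height c i
    f≡0⇔height≡ = mk⇔ (λ eq → ℤ.i-j≡0⇒i≡j _ _ (trans (sym (f≡height-diff c i t i≤t)) eq))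
                      (λ eq → trans (f≡height-diff c i t i≤t) (ℤ.i≡j⇒i-j≡0 eq))

  dnuTest-true⇒ : dnuTest c i t ≡ true → height c t ≡ height c i × cv c (suc t) ≡ 1
  dnuTest-true⇒ eq with ⌊⌋∧≡ᵇ1-true⇒ (f c (suc i) t ℤ.≟ + 0) (cv c (suc t)) eq
  ... | f≡0 , one = Equivalence.to f≡0⇔height≡ f≡0 , one

  dnuTest-false⇒ : dnuTest c i t ≡ false → height c t ≡ height c i → cv c (suc t) ≢ 1
  dnuTest-false⇒ eq level = ⌊⌋∧≡ᵇ1-false⇒ (f c (suc i) t ℤ.≟ + 0) (cv c (suc t)) eq (Equivalence.from f≡0⇔height≡ level)

  dnuTest-true : height c t ≡ height c i → cv c (suc t) ≡ 1 → dnuTest c i t ≡ true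
  dnuTest-true level one rewrite one = ⌊⌋∧≡ᵇ1-true (f c (suc i) t ℤ.≟ + 0) (Equivalence.from f≡0⇔height≡ level)

  dnuTest-false : (height c t ≡ height c i → cv c (suc t) ≢ 1) → dnuTest c i t ≡ false
  dnuTest-false ok = ⌊⌋∧≡ᵇ1-false (f c (suc i) t ℤ.≟ + 0) (cv c (suc t)) (ok ∘ Equivalence.to f≡0⇔height≡)

module _ (c : Vec ℕ n) (i : ℕ) {s : ℕ} (1≤s : 1 ≤ s) (s≤i : s ∸ 1 ≤ i ∸ 1) where

  private
    f≡height-diff′ : f c s (i ∸ 1) ≡ height c (i ∸ 1) ℤ.- height c (s ∸ 1)
    f≡height-diff′ = f-from≡height-diff c s (i ∸ 1) 1≤s s≤i

  doTest-false⇒ : doTest c i s ≡ false → height c (i ∸ 1) ℤ.≤ height c (s ∸ 1)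
  doTest-false⇒ eq = ℤ.i-j≤0⇒i≤j (subst (ℤ._≤ + 0) f≡height-diff′ (ℤ.≮⇒≥ (⌊⌋-false⇒¬ (+ 0 ℤ.<? f c s (i ∸ 1)) eq)))

  doTest-false : height c (i ∸ 1) ℤ.≤ height c (s ∸ 1) → doTest c i s ≡ false
  doTest-false below = ⌊⌋-false (+ 0 ℤ.<? f c s (i ∸ 1))
    (ℤ.≤⇒≯ (subst (ℤ._≤ + 0) (sym f≡height-diff′) (ℤ.i≤j⇒i-j≤0 below)))

height-rises : (c : Vec ℕ n) (t : ℕ) → 1 < cv c (suc t) → height c t ℤ.≤ height c (suc t)
height-rises c t big with cv c (suc t) | big
... | suc (suc k) | _ = ℤ.i≤i+j (height c t) (+ k)
... | 1           | s≤s ()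

module _ (c : Vec ℕ n) (parts-pos : ∀ t → 1 ≤ t → t ≤ n → 1 ≤ cv c t) (i : ℕ) (big-next : 1 < cv c (suc i))
         (K : ℕ) (K≤n : K ≤ n) (no-anchor : ∀ t → suc i ≤ t → t < K → height c t ≡ height c i → cv c (suc t) ≢ 1) where

  height≥-until-anchor : ∀ t → suc i ≤ t → t ≤ K → height c i ℤ.≤ height c t
  height≥-until-anchor (suc t) i<t+1 t<K with m≤n⇒m<n∨m≡n i<t+1
  ... | inj₂ refl = height-rises c i big-next
  ... | inj₁ i<t  = step-stays-above (cv c (suc t))
    (height≥-until-anchor t (≤-pred i<t) (≤-trans (n≤1+n t) t<K))
    (parts-pos (suc t) (s≤s z≤n) (≤-trans t<K K≤n))
    (no-anchor t (≤-pred i<t) t<K)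

big : ℕ → ℕ
big x = if 1 <ᵇ x then 1 else 0

big-1< : ∀ {x} → 1 < x → big x ≡ 1
big-1< 1<x = if-T (<⇒<ᵇ 1<x)

numBig≡sumMap-big : (v : Vec ℕ n) → numBig v ≡ sumMap big v
numBig≡sumMap-big []      = refl
numBig≡sumMap-big (x ∷ v) with 1 <ᵇ x
... | true  = cong suc (numBig≡sumMap-big v)
... | false = numBig≡sumMap-big v

sum≡sumMap-id : (v : Vec ℕ n) → Vec.sum v ≡ sumMap id v
sum≡sumMap-id v = cong Vec.sum (sym (map-id v))

-- The entry rules of stepDnu and stepDo, named because at-build cannot infer them.

dnuPart : Vec ℕ n → ℕ → ℕ → ℕ → ℕ
dnuPart c i j t = if t ≡ᵇ i then cv c i + cv c (suc i) ∸ 1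
                  else if between (suc i) t (j ∸ 1) then cv c (suc t)
                  else if t ≡ᵇ j then 1
                  else cv c t

dnuLabel : Vec ℕ n → ℕ → ℕ → ℕ → ℕ
dnuLabel l i j t = if between i t (j ∸ 1) then lv l (suc t)
                   else if t ≡ᵇ j then lv l i
                   else lv l t

doPart : Vec ℕ n → ℕ → ℕ → ℕ → ℕ
doPart c i j t = if t ≡ᵇ j then ∣ f c j (i ∸ 1) ∣ + 1
                 else if t ≡ᵇ suc j then cv c j ∸ ∣ f c j (i ∸ 1) ∣
                 else if between (suc (suc j)) t i then cv c (t ∸ 1)
                 else cv c t

doLabel : Vec ℕ n → ℕ → ℕ → ℕ → ℕ
doLabel l i j t = if t ≡ᵇ j then lv l i
                  else if between (suc j) t i then lv l (t ∸ 1)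
                  else lv l t

module StepDnu (c l : Vec ℕ n) (i j : ℕ) (1≤i : 1 ≤ i) (i<j : i < j) (j≤n : j ≤ n) where

  c′ l′ : Vec ℕ n
  c′ = proj₁ (stepDnu c l i j)
  l′ = proj₂ (stepDnu c l i j)

  private
    1≤j : 1 ≤ j
    1≤j = ≤-trans 1≤i (<⇒≤ i<j)
    i≤n : i ≤ n
    i≤n = ≤-trans (<⇒≤ i<j) j≤n
    j-1<j : j ∸ 1 < j
    j-1<j = n∸1<n 1≤j

  c′-at-i : cv c′ i ≡ cv c i + cv c (suc i) ∸ 1
  c′-at-i = trans (at-build 1 n (dnuPart c i j) i 1≤i i≤n) (if-T (≡ᵇ-refl i))

  c′-inside : ∀ t → i < t → t < j → cv c′ t ≡ cv c (suc t)
  c′-inside t i<t t<j = trans (at-build 1 n (dnuPart c i j) t (≤-trans (s≤s z≤n) i<t) (≤-trans (<⇒≤ t<j) j≤n))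
    (trans (if-¬T (≢⇒¬≡ᵇ t i (>⇒≢ i<t))) (if-T (between-inside (suc i) t (j ∸ 1) i<t (m<n⇒m≤n∸1 t<j))))

  c′-at-j : cv c′ j ≡ 1
  c′-at-j = trans (at-build 1 n (dnuPart c i j) j 1≤j j≤n)
    (trans (if-¬T (≢⇒¬≡ᵇ j i (>⇒≢ i<j))) (trans (if-¬T (between-above (suc i) j (j ∸ 1) j-1<j)) (if-T (≡ᵇ-refl j))))

  c′-below : ∀ t → t < i → cv c′ t ≡ cv c t
  c′-below zero    _   = trans (at-zero 1 c′) (sym (at-zero 1 c))
  c′-below (suc t) t<i = trans (at-build 1 n (dnuPart c i j) (suc t) (s≤s z≤n) (≤-trans (<⇒≤ (<-trans t<i i<j)) j≤n))
    (trans (if-¬T (≢⇒¬≡ᵇ (suc t) i (<⇒≢ t<i))) (trans (if-¬T (between-below (suc i) (suc t) (j ∸ 1) (m<n⇒m<1+n t<i)))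
      (if-¬T (≢⇒¬≡ᵇ (suc t) j (<⇒≢ (<-trans t<i i<j))))))

  c′-above : ∀ t → j < t → cv c′ t ≡ cv c t
  c′-above t j<t with t ≤? n
  ... | no  t≰n = trans (at-beyond 1 c′ t (≰⇒> t≰n)) (sym (at-beyond 1 c t (≰⇒> t≰n)))
  ... | yes t≤n = trans (at-build 1 n (dnuPart c i j) t (≤-trans 1≤j (<⇒≤ j<t)) t≤n)
    (trans (if-¬T (≢⇒¬≡ᵇ t i (>⇒≢ (<-trans i<j j<t)))) (trans (if-¬T (between-above (suc i) t (j ∸ 1) (<-trans j-1<j j<t)))
      (if-¬T (≢⇒¬≡ᵇ t j (>⇒≢ j<t)))))

  l′-inside : ∀ t → i ≤ t → t < j → lv l′ t ≡ lv l (suc t)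
  l′-inside t i≤t t<j = trans (at-build 0 n (dnuLabel l i j) t (≤-trans 1≤i i≤t) (≤-trans (<⇒≤ t<j) j≤n))
    (if-T (between-inside i t (j ∸ 1) i≤t (m<n⇒m≤n∸1 t<j)))

  l′-at-j : lv l′ j ≡ lv l i
  l′-at-j = trans (at-build 0 n (dnuLabel l i j) j 1≤j j≤n) (trans (if-¬T (between-above i j (j ∸ 1) j-1<j)) (if-T (≡ᵇ-refl j)))

  l′-below : ∀ t → t < i → lv l′ t ≡ lv l t
  l′-below zero    _   = trans (at-zero 0 l′) (sym (at-zero 0 l))
  l′-below (suc t) t<i = trans (at-build 0 n (dnuLabel l i j) (suc t) (s≤s z≤n) (≤-trans (<⇒≤ (<-trans t<i i<j)) j≤n))
    (trans (if-¬T (between-below i (suc t) (j ∸ 1) t<i)) (if-¬T (≢⇒¬≡ᵇ (suc t) j (<⇒≢ (<-trans t<i i<j)))))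

  l′-above : ∀ t → j < t → lv l′ t ≡ lv l t
  l′-above t j<t with t ≤? n
  ... | no  t≰n = trans (at-beyond 0 l′ t (≰⇒> t≰n)) (sym (at-beyond 0 l t (≰⇒> t≰n)))
  ... | yes t≤n = trans (at-build 0 n (dnuLabel l i j) t (≤-trans 1≤j (<⇒≤ j<t)) t≤n)
    (trans (if-¬T (between-above i t (j ∸ 1) (<-trans j-1<j j<t))) (if-¬T (≢⇒¬≡ᵇ t j (>⇒≢ j<t))))

  posOf-l′ : ∀ {a} → LabelsDistinct n l → IsPosOf a l i → posOf a l′ ≡ just j
  posOf-l′ {a} distinct (_ , _ , li≡a , before) = posOf-complete a l′ (1≤j , j≤n , trans l′-at-j li≡a , before′)
    where
    before′ : ∀ t → 1 ≤ t → t < j → lv l′ t ≢ a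
    before′ t 1≤t t<j l′t≡a with t <? i
    ... | yes t<i = before t 1≤t t<i (trans (sym (l′-below t t<i)) l′t≡a)
    ... | no  t≮i = 1+n≰n (subst (_≤ t) (sym t+1≡i) (≮⇒≥ t≮i))
      where
      t+1≡i : suc t ≡ i
      t+1≡i = distinct (suc t) i (s≤s z≤n) (≤-trans t<j j≤n) 1≤i i≤n
                (trans (sym (l′-inside t (≮⇒≥ t≮i) t<j)) (trans l′t≡a (sym li≡a)))

  merged : ℕ
  merged = cv c i + cv c (suc i) ∸ 1

  private
    i+1≤n : suc i ≤ n
    i+1≤n = ≤-trans i<j j≤n
    u₁ u : Vec ℕ n
    u₁ = setAt c i merged
    u  = setAt u₁ (suc i) 1

    u-at-i : cv u i ≡ merged
    u-at-i = trans (at-setAt-other 1 u₁ (suc i) 1 i (<⇒≢ ≤-refl)) (at-setAt-same 1 c i merged 1≤i i≤n)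
    u-at-i+1 : cv u (suc i) ≡ 1
    u-at-i+1 = at-setAt-same 1 u₁ (suc i) 1 (s≤s z≤n) i+1≤n
    u-other : ∀ t → t ≢ i → t ≢ suc i → cv u t ≡ cv c t
    u-other t t≢i t≢i+1 = trans (at-setAt-other 1 u₁ (suc i) 1 t t≢i+1) (at-setAt-other 1 c i merged t t≢i)

    i+1+[j-i-1]≡j : suc i + (j ∸ suc i) ≡ j
    i+1+[j-i-1]≡j = m+[n∸m]≡n i<j
    i+[j-i]≡j : i + (j ∸ i) ≡ j
    i+[j-i]≡j = m+[n∸m]≡n (<⇒≤ i<j)

  c′≡moveRight : c′ ≡ moveRight u (suc i) (j ∸ suc i)
  c′≡moveRight = at-ext 1 c′ (moveRight u (suc i) (j ∸ suc i)) same
    where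
    end≤n : suc i + (j ∸ suc i) ≤ n
    end≤n = subst (_≤ n) (sym i+1+[j-i-1]≡j) j≤n
    same : ∀ t → 1 ≤ t → t ≤ n → cv c′ t ≡ cv (moveRight u (suc i) (j ∸ suc i)) t
    same t _ _ with <-cmp t i
    ... | tri< t<i _ _ = trans (c′-below t t<i) (sym (trans
          (at-moveRight-below 1 u (suc i) (j ∸ suc i) t (s≤s z≤n) end≤n (m<n⇒m<1+n t<i))
          (u-other t (<⇒≢ t<i) (<⇒≢ (m<n⇒m<1+n t<i)))))
    ... | tri≈ _ refl _ = trans c′-at-i (sym (trans
          (at-moveRight-below 1 u (suc i) (j ∸ suc i) t (s≤s z≤n) end≤n ≤-refl) u-at-i))
    ... | tri> _ _ i<t with <-cmp t j
    ... | tri< t<j _ _ = trans (c′-inside t i<t t<j) (sym (trans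
          (at-moveRight-between 1 u (suc i) (j ∸ suc i) t (s≤s z≤n) end≤n i<t (subst (t <_) (sym i+1+[j-i-1]≡j) t<j))
          (u-other (suc t) (>⇒≢ (m<n⇒m<1+n i<t)) (>⇒≢ (s≤s i<t)))))
    ... | tri≈ _ refl _ = trans c′-at-j (sym (trans (cong (cv (moveRight u (suc i) (j ∸ suc i))) (sym i+1+[j-i-1]≡j))
          (trans (at-moveRight-target 1 u (suc i) (j ∸ suc i) (s≤s z≤n) end≤n) u-at-i+1)))
    ... | tri> _ _ j<t = trans (c′-above t j<t) (sym (trans
          (at-moveRight-above 1 u (suc i) (j ∸ suc i) t (s≤s z≤n) end≤n (subst (_< t) (sym i+1+[j-i-1]≡j) j<t))
          (u-other t (>⇒≢ (<-trans i<j j<t)) (>⇒≢ (≤-<-trans i<j j<t)))))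

  l′≡moveRight : l′ ≡ moveRight l i (j ∸ i)
  l′≡moveRight = at-ext 0 l′ (moveRight l i (j ∸ i)) same
    where
    end≤n : i + (j ∸ i) ≤ n
    end≤n = subst (_≤ n) (sym i+[j-i]≡j) j≤n
    same : ∀ t → 1 ≤ t → t ≤ n → lv l′ t ≡ lv (moveRight l i (j ∸ i)) t
    same t _ _ with <-cmp t i
    ... | tri< t<i _ _ = trans (l′-below t t<i) (sym (at-moveRight-below 0 l i (j ∸ i) t 1≤i end≤n t<i))
    ... | tri≈ _ refl _ = trans (l′-inside t ≤-refl i<j)
          (sym (at-moveRight-between 0 l i (j ∸ i) t 1≤i end≤n ≤-refl (subst (t <_) (sym i+[j-i]≡j) i<j)))
    ... | tri> _ _ i<t with <-cmp t j
    ... | tri< t<j _ _ = trans (l′-inside t (<⇒≤ i<t) t<j)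
          (sym (at-moveRight-between 0 l i (j ∸ i) t 1≤i end≤n (<⇒≤ i<t) (subst (t <_) (sym i+[j-i]≡j) t<j)))
    ... | tri≈ _ refl _ = trans l′-at-j (sym (trans (cong (lv (moveRight l i (j ∸ i))) (sym i+[j-i]≡j))
          (at-moveRight-target 0 l i (j ∸ i) 1≤i end≤n)))
    ... | tri> _ _ j<t = trans (l′-above t j<t)
          (sym (at-moveRight-above 0 l i (j ∸ i) t 1≤i end≤n (subst (_< t) (sym i+[j-i]≡j) j<t)))

  l′-↭ : toList l′ ↭ toList l
  l′-↭ = subst (λ v → toList v ↭ toList l) (sym l′≡moveRight) (moveRight-↭ l i (j ∸ i))

  -- as multisets, c′ is c with the parts c_i, c_{i+1} replaced by merged and 1
  sumMap-c′ : ∀ h → sumMap h c′ + (h (cv c i) + h (cv c (suc i))) ≡ sumMap h c + (h merged + h 1)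
  sumMap-c′ h = begin
    Σc′ + (h (cv c i) + h (cv c (suc i)))
      ≡⟨ +-assoc Σc′ (h (cv c i)) _ ⟨
    Σc′ + h (cv c i) + h (cv c (suc i))
      ≡⟨ cong (λ v → sumMap h v + h (cv c i) + h (cv c (suc i))) c′≡moveRight ⟩
    sumMap h (moveRight u (suc i) (j ∸ suc i)) + h (cv c i) + h (cv c (suc i))
      ≡⟨ cong (λ s → s + h (cv c i) + h (cv c (suc i))) (sumMap-moveRight h u (suc i) (j ∸ suc i)) ⟩
    Σu + h (cv c i) + h (cv c (suc i))
      ≡⟨ xy∙z≈xz∙y Σu (h (cv c i)) (h (cv c (suc i))) ⟩
    Σu + h (cv c (suc i)) + h (cv c i)
      ≡⟨ cong (λ s → Σu + h s + h (cv c i)) (sym (at-setAt-other 1 c i merged (suc i) (>⇒≢ ≤-refl))) ⟩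
    Σu + h (cv u₁ (suc i)) + h (cv c i)
      ≡⟨ cong (_+ h (cv c i)) (sumMap-setAt h u₁ (suc i) 1 (s≤s z≤n) i+1≤n) ⟩
    Σu₁ + h 1 + h (cv c i)
      ≡⟨ xy∙z≈xz∙y Σu₁ (h 1) (h (cv c i)) ⟩
    Σu₁ + h (cv c i) + h 1
      ≡⟨ cong (_+ h 1) (sumMap-setAt h c i merged 1≤i i≤n) ⟩
    sumMap h c + h merged + h 1
      ≡⟨ +-assoc (sumMap h c) (h merged) _ ⟩
    sumMap h c + (h merged + h 1) ∎
    where
    open ≡-Reasoning
    Σc′ Σu Σu₁ : ℕ
    Σc′ = sumMap h c′
    Σu  = sumMap h u
    Σu₁ = sumMap h u₁

module StepDo (c l : Vec ℕ n) (i j : ℕ) (1≤j : 1 ≤ j) (j<i : j < i) (i≤n : i ≤ n) where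

  c′ l′ : Vec ℕ n
  c′ = proj₁ (stepDo c l i j)
  l′ = proj₂ (stepDo c l i j)

  α : ℕ
  α = ∣ f c j (i ∸ 1) ∣

  private
    j≤n : j ≤ n
    j≤n = ≤-trans (<⇒≤ j<i) i≤n
    1≤i : 1 ≤ i
    1≤i = ≤-trans 1≤j (<⇒≤ j<i)

  c′-at-j : cv c′ j ≡ α + 1
  c′-at-j = trans (at-build 1 n (doPart c i j) j 1≤j j≤n) (if-T (≡ᵇ-refl j))

  c′-at-j+1 : cv c′ (suc j) ≡ cv c j ∸ α
  c′-at-j+1 = trans (at-build 1 n (doPart c i j) (suc j) (s≤s z≤n) (≤-trans j<i i≤n))
    (trans (if-¬T (≢⇒¬≡ᵇ (suc j) j (>⇒≢ ≤-refl))) (if-T (≡ᵇ-refl (suc j))))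

  c′-inside : ∀ t → suc j < t → t ≤ i → cv c′ t ≡ cv c (t ∸ 1)
  c′-inside t j+1<t t≤i = trans (at-build 1 n (doPart c i j) t (≤-trans (s≤s z≤n) j+1<t) (≤-trans t≤i i≤n))
    (trans (if-¬T (≢⇒¬≡ᵇ t j (>⇒≢ (≤-trans (n≤1+n (suc j)) j+1<t))))
      (trans (if-¬T (≢⇒¬≡ᵇ t (suc j) (>⇒≢ j+1<t))) (if-T (between-inside (suc (suc j)) t i j+1<t t≤i))))

  c′-below : ∀ t → t < j → cv c′ t ≡ cv c t
  c′-below zero    _   = trans (at-zero 1 c′) (sym (at-zero 1 c))
  c′-below (suc t) t<j = trans (at-build 1 n (doPart c i j) (suc t) (s≤s z≤n) (≤-trans (<⇒≤ t<j) j≤n))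
    (trans (if-¬T (≢⇒¬≡ᵇ (suc t) j (<⇒≢ t<j))) (trans (if-¬T (≢⇒¬≡ᵇ (suc t) (suc j) (<⇒≢ (m<n⇒m<1+n t<j))))
      (if-¬T (between-below (suc (suc j)) (suc t) i (m<n⇒m<1+n (m<n⇒m<1+n t<j))))))

  c′-above : ∀ t → i < t → cv c′ t ≡ cv c t
  c′-above t i<t with t ≤? n
  ... | no  t≰n = trans (at-beyond 1 c′ t (≰⇒> t≰n)) (sym (at-beyond 1 c t (≰⇒> t≰n)))
  ... | yes t≤n = trans (at-build 1 n (doPart c i j) t (≤-trans 1≤i (<⇒≤ i<t)) t≤n)
    (trans (if-¬T (≢⇒¬≡ᵇ t j (>⇒≢ (<-trans j<i i<t)))) (trans (if-¬T (≢⇒¬≡ᵇ t (suc j) (>⇒≢ (≤-<-trans j<i i<t))))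
      (if-¬T (between-above (suc (suc j)) t i i<t))))

  l′-at-j : lv l′ j ≡ lv l i
  l′-at-j = trans (at-build 0 n (doLabel l i j) j 1≤j j≤n) (if-T (≡ᵇ-refl j))

  l′-inside : ∀ t → j < t → t ≤ i → lv l′ t ≡ lv l (t ∸ 1)
  l′-inside t j<t t≤i = trans (at-build 0 n (doLabel l i j) t (≤-trans (s≤s z≤n) j<t) (≤-trans t≤i i≤n))
    (trans (if-¬T (≢⇒¬≡ᵇ t j (>⇒≢ j<t))) (if-T (between-inside (suc j) t i j<t t≤i)))

  l′-below : ∀ t → t < j → lv l′ t ≡ lv l t
  l′-below zero    _   = trans (at-zero 0 l′) (sym (at-zero 0 l))
  l′-below (suc t) t<j = trans (at-build 0 n (doLabel l i j) (suc t) (s≤s z≤n) (≤-trans (<⇒≤ t<j) j≤n))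
    (trans (if-¬T (≢⇒¬≡ᵇ (suc t) j (<⇒≢ t<j))) (if-¬T (between-below (suc j) (suc t) i (m<n⇒m<1+n t<j))))

  l′-above : ∀ t → i < t → lv l′ t ≡ lv l t
  l′-above t i<t with t ≤? n
  ... | no  t≰n = trans (at-beyond 0 l′ t (≰⇒> t≰n)) (sym (at-beyond 0 l t (≰⇒> t≰n)))
  ... | yes t≤n = trans (at-build 0 n (doLabel l i j) t (≤-trans 1≤i (<⇒≤ i<t)) t≤n)
    (trans (if-¬T (≢⇒¬≡ᵇ t j (>⇒≢ (<-trans j<i i<t)))) (if-¬T (between-above (suc j) t i i<t)))

  posOf-l′ : ∀ {a} → IsPosOf a l i → posOf a l′ ≡ just j
  posOf-l′ {a} (_ , _ , li≡a , before) = posOf-complete a l′ (1≤j , j≤n , trans l′-at-j li≡a ,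
    λ t 1≤t t<j l′t≡a → before t 1≤t (<-trans t<j j<i) (trans (sym (l′-below t t<j)) l′t≡a))

module DnuMove {c : Vec ℕ n} (dc : DComp n c) (l : Vec ℕ n) {i j : ℕ} (1≤i : 1 ≤ i) (i≤n : i ≤ n)
               (dnu : IsDnu c i) (anchor : apDnu c i ≡ just j) where

  private
    anchor-spec : IsFirstIn (dnuTest c i) (suc i) (n ∸ i) j
    anchor-spec = firstIn-just _ _ _ _ anchor

    i<j : i < j
    i<j = proj₁ anchor-spec
    j≤n : j ≤ n
    j≤n = ≤-pred (subst (j <_) (cong suc (m+[n∸m]≡n i≤n)) (proj₁ (proj₂ anchor-spec)))
    1≤j : 1 ≤ j
    1≤j = ≤-trans 1≤i (<⇒≤ i<j)

    anchor-level : height c j ≡ height c i × cv c (suc j) ≡ 1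
    anchor-level = dnuTest-true⇒ c (<⇒≤ i<j) (proj₁ (proj₂ (proj₂ anchor-spec)))

    height-c≥ : ∀ t → suc i ≤ t → t ≤ j → height c i ℤ.≤ height c t
    height-c≥ = height≥-until-anchor c (DComp⇒1≤part dc) i (proj₂ dnu) j j≤n
      λ t i<t t<j → dnuTest-false⇒ c (<⇒≤ i<t) (proj₂ (proj₂ (proj₂ anchor-spec)) t i<t t<j)

  open StepDnu c l i j 1≤i i<j j≤n public

  height-c′-below : ∀ t → t < i → height c′ t ≡ height c t
  height-c′-below t t<i = trans (height-shift c c′ 0 0 (+ 0) t refl λ s _ s≤t → c′-below s (≤-<-trans s≤t t<i))
                                (ℤ.+-identityʳ (height c t))

  height-c′-at-i : height c′ i ≡ height c (suc i) ℤ.+ + 1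
  height-c′-at-i = begin
    height c′ i
      ≡⟨ height-pred c′ i 1≤i ⟩
    height c′ (i ∸ 1) ℤ.+ (+ cv c′ i ℤ.- + 2)
      ≡⟨ cong₂ (λ h x → h ℤ.+ (+ x ℤ.- + 2)) (height-c′-below (i ∸ 1) (n∸1<n 1≤i)) c′-at-i ⟩
    height c (i ∸ 1) ℤ.+ (+ merged ℤ.- + 2)
      ≡⟨ cong (λ z → height c (i ∸ 1) ℤ.+ (z ℤ.- + 2)) merged-in-ℤ ⟩
    height c (i ∸ 1) ℤ.+ (+ cv c i ℤ.+ (+ cv c (suc i) ℤ.- + 1) ℤ.- + 2)
      ≡⟨ regroup (height c (i ∸ 1)) (+ cv c i) (+ cv c (suc i)) ⟩
    height c (i ∸ 1) ℤ.+ step c i ℤ.+ step c (suc i) ℤ.+ + 1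
      ≡⟨ cong (λ h → h ℤ.+ step c (suc i) ℤ.+ + 1) (height-pred c i 1≤i) ⟨
    height c (suc i) ℤ.+ + 1 ∎
    where
    open ≡-Reasoning
    merged-in-ℤ : + merged ≡ + cv c i ℤ.+ (+ cv c (suc i) ℤ.- + 1)
    merged-in-ℤ = trans (cong +_ (+-∸-assoc (cv c i) (<⇒≤ (proj₂ dnu))))
                        (trans (ℤ.pos-+ (cv c i) _) (cong (λ z → + cv c i ℤ.+ z) (+[m∸n]≡+m-+n (<⇒≤ (proj₂ dnu)))))
    regroup : ∀ (h x y : ℤ) → h ℤ.+ (x ℤ.+ (y ℤ.- + 1) ℤ.- + 2) ≡ h ℤ.+ (x ℤ.- + 2) ℤ.+ (y ℤ.- + 2) ℤ.+ + 1
    regroup = solve-∀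

  height-c′-inside : ∀ t → i ≤ t → t < j → height c′ t ≡ height c (suc t) ℤ.+ + 1
  height-c′-inside t i≤t t<j = subst (λ z → height c′ z ≡ height c (suc z) ℤ.+ + 1) (m+[n∸m]≡n i≤t)
    (height-shift c c′ i (suc i) (+ 1) (t ∸ i) height-c′-at-i
      λ s 1≤s s≤t-i → c′-inside (i + s) (m<m+n i 1≤s)
        (≤-<-trans (subst (i + s ≤_) (m+[n∸m]≡n i≤t) (+-monoʳ-≤ i s≤t-i)) t<j))

  height-c′-before-j : height c′ (j ∸ 1) ≡ height c i ℤ.+ + 1
  height-c′-before-j = trans (height-c′-inside (j ∸ 1) (m<n⇒m≤n∸1 i<j) (n∸1<n 1≤j))
                             (cong (λ h → h ℤ.+ + 1) (trans (cong (height c) (m+[n∸m]≡n 1≤j)) (proj₁ anchor-level)))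

  height-c′-from-j : ∀ t → j ≤ t → height c′ t ≡ height c t
  height-c′-from-j t j≤t = subst (λ z → height c′ z ≡ height c z) (m+[n∸m]≡n j≤t)
    (trans (height-shift c c′ j j (+ 0) (t ∸ j) (trans at-j (sym (ℤ.+-identityʳ (height c j))))
             λ s 1≤s _ → c′-above (j + s) (m<m+n j 1≤s))
           (ℤ.+-identityʳ _))
    where
    at-j : height c′ j ≡ height c j
    at-j = begin
      height c′ j                                ≡⟨ height-pred c′ j 1≤j ⟩
      height c′ (j ∸ 1) ℤ.+ (+ cv c′ j ℤ.- + 2)  ≡⟨ cong₂ (λ h x → h ℤ.+ (+ x ℤ.- + 2)) height-c′-before-j c′-at-j ⟩
      height c i ℤ.+ + 1 ℤ.+ (+ 1 ℤ.- + 2)       ≡⟨ x+1-1≡x (height c i) ⟩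
      height c i                                 ≡⟨ proj₁ anchor-level ⟨
      height c j                                 ∎
      where
      open ≡-Reasoning
      x+1-1≡x : ∀ (x : ℤ) → x ℤ.+ + 1 ℤ.+ (+ 1 ℤ.- + 2) ≡ x
      x+1-1≡x = solve-∀

  1<merged : 1 < merged
  1<merged = 1<m+n∸1 (proj₁ dnu) (<⇒≤ (proj₂ dnu))

  sum-c′ : Vec.sum c′ ≡ Vec.sum c
  sum-c′ = begin
    Vec.sum c′    ≡⟨ sum≡sumMap-id c′ ⟩
    sumMap id c′  ≡⟨ +-cancelʳ-≡ (cv c i + cv c (suc i)) _ _ (trans (sumMap-c′ id) (cong (λ k → sumMap id c + k) merged+1)) ⟩
    sumMap id c   ≡⟨ sum≡sumMap-id c ⟨
    Vec.sum c     ∎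
    where
    open ≡-Reasoning
    merged+1 : merged + 1 ≡ cv c i + cv c (suc i)
    merged+1 = m∸n+n≡m (≤-trans (<⇒≤ (proj₂ dnu)) (m≤n+m _ (cv c i)))

  1≤c′ : ∀ t → 1 ≤ t → t ≤ n → 1 ≤ cv c′ t
  1≤c′ t 1≤t t≤n with <-cmp t i
  ... | tri< t<i _ _ = subst (1 ≤_) (sym (c′-below t t<i)) (DComp⇒1≤part dc t 1≤t t≤n)
  ... | tri≈ _ refl _ = subst (1 ≤_) (sym c′-at-i) (<⇒≤ 1<merged)
  ... | tri> _ _ i<t with <-cmp t j
  ... | tri< t<j _ _ = subst (1 ≤_) (sym (c′-inside t i<t t<j)) (DComp⇒1≤part dc (suc t) (s≤s z≤n) (≤-trans t<j j≤n))
  ... | tri≈ _ refl _ = subst (1 ≤_) (sym c′-at-j) ≤-refl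
  ... | tri> _ _ j<t = subst (1 ≤_) (sym (c′-above t j<t)) (DComp⇒1≤part dc t 1≤t t≤n)

  0<height-c′ : ∀ t → 1 ≤ t → t ≤ n → + 0 ℤ.< height c′ t
  0<height-c′ t 1≤t t≤n with t <? i | t <? j
  ... | yes t<i | _       = subst (+ 0 ℤ.<_) (sym (height-c′-below t t<i)) (DComp⇒0<height dc t 1≤t t≤n)
  ... | no  t≮i | yes t<j = subst (+ 0 ℤ.<_) (sym (height-c′-inside t (≮⇒≥ t≮i) t<j))
    (ℤ.<-≤-trans (DComp⇒0<height dc (suc t) (s≤s z≤n) (≤-trans t<j j≤n)) (ℤ.i≤i+j _ (+ 1)))
  ... | no  _   | no  t≮j = subst (+ 0 ℤ.<_) (sym (height-c′-from-j t (≮⇒≥ t≮j))) (DComp⇒0<height dc t 1≤t t≤n)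

  DComp-c′ : DComp n c′
  DComp-c′ = (at⇒All 1 c′ 1≤c′ , trans sum-c′ (proj₂ (proj₁ dc))) ,
             λ t 1≤t t≤n → subst (+ 0 ℤ.<_) (sym (f-from-1≡height c′ t)) (0<height-c′ t 1≤t t≤n)

  numBig-c′ : numBig c′ + 1 ≡ numBig c
  numBig-c′ = +-cancelʳ-≡ 1 _ _ (begin
    numBig c′ + 1 + 1
      ≡⟨ cong (λ k → k + 1 + 1) (numBig≡sumMap-big c′) ⟩
    sumMap big c′ + 1 + 1
      ≡⟨ +-assoc _ 1 1 ⟩
    sumMap big c′ + (1 + 1)
      ≡⟨ cong (λ k → sumMap big c′ + k) (sym (cong₂ _+_ (big-1< (proj₁ dnu)) (big-1< (proj₂ dnu)))) ⟩
    sumMap big c′ + (big (cv c i) + big (cv c (suc i)))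
      ≡⟨ sumMap-c′ big ⟩
    sumMap big c + (big merged + big 1)
      ≡⟨ cong₂ (λ k b → k + (b + 0)) (sym (numBig≡sumMap-big c)) (big-1< 1<merged) ⟩
    numBig c + 1 ∎)
    where open ≡-Reasoning

  IsPerm-l′ : IsPerm n l → IsPerm n l′
  IsPerm-l′ = ↭-trans l′-↭

  -- ψ_a undoes the move: in c′ the part at j is a Do part whose anchor point is i.

  IsDo-c′ : IsDo c′ j
  IsDo-c′ = c′-at-j , trans (c′-above (suc j) ≤-refl) (proj₂ anchor-level)

  f-c′-i : f c′ i (j ∸ 1) ≡ + (cv c i ∸ 1)
  f-c′-i = begin
    f c′ i (j ∸ 1)
      ≡⟨ f-from≡height-diff c′ i (j ∸ 1) 1≤i (∸-monoˡ-≤ 1 (<⇒≤ i<j)) ⟩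
    height c′ (j ∸ 1) ℤ.- height c′ (i ∸ 1)
      ≡⟨ cong₂ ℤ._-_ height-c′-before-j (height-c′-below (i ∸ 1) (n∸1<n 1≤i)) ⟩
    height c i ℤ.+ + 1 ℤ.- height c (i ∸ 1)
      ≡⟨ cong (λ h → h ℤ.+ + 1 ℤ.- height c (i ∸ 1)) (height-pred c i 1≤i) ⟩
    height c (i ∸ 1) ℤ.+ step c i ℤ.+ + 1 ℤ.- height c (i ∸ 1)
      ≡⟨ cancel (height c (i ∸ 1)) (+ cv c i) ⟩
    + cv c i ℤ.- + 1
      ≡⟨ +[m∸n]≡+m-+n (<⇒≤ (proj₁ dnu)) ⟨
    + (cv c i ∸ 1) ∎
    where
    open ≡-Reasoning
    cancel : ∀ (h x : ℤ) → h ℤ.+ (x ℤ.- + 2) ℤ.+ + 1 ℤ.- h ≡ x ℤ.- + 1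
    cancel = solve-∀

  apDo-c′ : apDo c′ j ≡ just i
  apDo-c′ = lastIn-complete (doTest c′ j) 1 (j ∸ 1) i
    (1≤i , subst (i <_) (sym (m+[n∸m]≡n 1≤j)) i<j ,
     ⌊⌋-true (+ 0 ℤ.<? f c′ i (j ∸ 1)) (subst (+ 0 ℤ.<_) (sym f-c′-i) (+<+ (∸-monoˡ-≤ 1 (proj₁ dnu)))) ,
     λ s i<s s<1+[j-1] → no-lower s i<s (subst (s <_) (m+[n∸m]≡n 1≤j) s<1+[j-1]))
    where
    no-lower : ∀ s → i < s → s < j → doTest c′ j s ≡ false
    no-lower s i<s s<j = doTest-false c′ j (≤-trans 1≤i (<⇒≤ i<s)) (∸-monoˡ-≤ 1 (<⇒≤ s<j)) (begin
      height c′ (j ∸ 1)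
        ≡⟨ height-c′-before-j ⟩
      height c i ℤ.+ + 1
        ≤⟨ ℤ.+-monoˡ-≤ (+ 1) (height-c≥ s i<s (<⇒≤ s<j)) ⟩
      height c s ℤ.+ + 1
        ≡⟨ cong (λ z → height c z ℤ.+ + 1) (m+[n∸m]≡n (≤-trans (s≤s z≤n) i<s)) ⟨
      height c (suc (s ∸ 1)) ℤ.+ + 1
        ≡⟨ height-c′-inside (s ∸ 1) (m<n⇒m≤n∸1 i<s) (≤-<-trans (m∸n≤m s 1) s<j) ⟨
      height c′ (s ∸ 1) ∎)
      where open ℤ.≤-Reasoning

  private
    module Back = StepDo c′ l′ j i 1≤i i<j j≤n

    α-back : Back.α ≡ cv c i ∸ 1
    α-back = cong ∣_∣ f-c′-i

    t-1<j : ∀ {t} → i < t → t ≤ j → t ∸ 1 < j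
    t-1<j i<t t≤j = <-≤-trans (n∸1<n (≤-trans (s≤s z≤n) i<t)) t≤j

    1+[t-1]≡t : ∀ {t} → i < t → suc (t ∸ 1) ≡ t
    1+[t-1]≡t i<t = m+[n∸m]≡n (≤-trans (s≤s z≤n) i<t)

    back-parts : ∀ t → 1 ≤ t → t ≤ n → cv Back.c′ t ≡ cv c t
    back-parts t _ _ with <-cmp t i
    ... | tri< t<i _ _  = trans (Back.c′-below t t<i) (c′-below t t<i)
    ... | tri≈ _ refl _ = trans Back.c′-at-j (trans (cong (_+ 1) α-back) (m∸n+n≡m (<⇒≤ (proj₁ dnu))))
    ... | tri> _ _ i<t with m≤n⇒m<n∨m≡n i<t | t ≤? j
    ...   | inj₂ refl  | _       = trans Back.c′-at-j+1
      (trans (cong₂ _∸_ c′-at-i α-back) (m+n∸1∸[m∸1]≡n (cv c i) (<⇒≤ (proj₁ dnu))))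
      where
      m+n∸1∸[m∸1]≡n : ∀ m {k} → 1 ≤ m → m + k ∸ 1 ∸ (m ∸ 1) ≡ k
      m+n∸1∸[m∸1]≡n (suc m) {k} _ = m+n∸m≡n m k
    ...   | inj₁ i+1<t | yes t≤j = trans (Back.c′-inside t i+1<t t≤j)
      (trans (c′-inside (t ∸ 1) (m<n⇒m≤n∸1 i+1<t) (t-1<j i<t t≤j)) (cong (cv c) (1+[t-1]≡t i<t)))
    ...   | inj₁ _     | no  t≰j = trans (Back.c′-above t (≰⇒> t≰j)) (c′-above t (≰⇒> t≰j))

    back-labels : ∀ t → 1 ≤ t → t ≤ n → lv Back.l′ t ≡ lv l t
    back-labels t _ _ with <-cmp t i
    ... | tri< t<i _ _  = trans (Back.l′-below t t<i) (l′-below t t<i)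
    ... | tri≈ _ refl _ = trans Back.l′-at-j l′-at-j
    ... | tri> _ _ i<t with t ≤? j
    ...   | yes t≤j = trans (Back.l′-inside t i<t t≤j)
      (trans (l′-inside (t ∸ 1) (m<n⇒m≤n∸1 i<t) (t-1<j i<t t≤j)) (cong (lv l) (1+[t-1]≡t i<t)))
    ...   | no  t≰j = trans (Back.l′-above t (≰⇒> t≰j)) (l′-above t (≰⇒> t≰j))

  stepDo-c′ : stepDo c′ l′ j i ≡ (c , l)
  stepDo-c′ = cong₂ _,_ (at-ext 1 Back.c′ c back-parts) (at-ext 0 Back.l′ l back-labels)

module DoMove {c : Vec ℕ n} (dc : DComp n c) (l : Vec ℕ n) {i j : ℕ} (1≤i : 1 ≤ i) (i≤n : i ≤ n)
              (isDo : IsDo c i) (anchor : apDo c i ≡ just j) where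

  private
    anchor-spec : IsLastIn (doTest c i) 1 (i ∸ 1) j
    anchor-spec = lastIn-just _ _ _ _ anchor

    1≤j : 1 ≤ j
    1≤j = proj₁ anchor-spec
    j<i : j < i
    j<i = subst (j <_) (m+[n∸m]≡n 1≤i) (proj₁ (proj₂ anchor-spec))
    j≤n : j ≤ n
    j≤n = ≤-trans (<⇒≤ j<i) i≤n

    0<f : + 0 ℤ.< f c j (i ∸ 1)
    0<f = ⌊⌋-true⇒ (+ 0 ℤ.<? f c j (i ∸ 1)) (proj₁ (proj₂ (proj₂ anchor-spec)))

    height-c≥ : ∀ t → j ≤ t → t ≤ i ∸ 1 → height c (i ∸ 1) ℤ.≤ height c t
    height-c≥ t j≤t t≤i-1 with m≤n⇒m<n∨m≡n t≤i-1
    ... | inj₂ refl  = ℤ.≤-refl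
    ... | inj₁ t<i-1 = doTest-false⇒ c i (s≤s z≤n) t≤i-1
      (proj₂ (proj₂ (proj₂ anchor-spec)) (suc t) (s≤s j≤t) (s≤s t<i-1))

  open StepDo c l i j 1≤j j<i i≤n public

  +α : + α ≡ height c (i ∸ 1) ℤ.- height c (j ∸ 1)
  +α = trans (ℤ.0≤i⇒+∣i∣≡i (ℤ.<⇒≤ 0<f)) (f-from≡height-diff c j (i ∸ 1) 1≤j (∸-monoˡ-≤ 1 (<⇒≤ j<i)))

  1≤α : 1 ≤ α
  1≤α = ℤ.drop‿+≤+ (subst (+ 1 ℤ.≤_) (sym (ℤ.0≤i⇒+∣i∣≡i (ℤ.<⇒≤ 0<f))) (ℤ.i<j⇒suc[i]≤j 0<f))

  height-c-at-i : height c i ≡ height c (i ∸ 1) ℤ.- + 1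
  height-c-at-i = trans (height-pred c i 1≤i) (cong (λ x → height c (i ∸ 1) ℤ.+ (+ x ℤ.- + 2)) (proj₁ isDo))

  -- the part at j is large enough to split off α + 1, since height c j ≥ height c (i ∸ 1)
  α+2≤c-j : α + 2 ≤ cv c j
  α+2≤c-j = ℤ.drop‿+≤+ (begin
    + α ℤ.+ + 2
      ≡⟨ cong (ℤ._+ + 2) +α ⟩
    height c (i ∸ 1) ℤ.- height c (j ∸ 1) ℤ.+ + 2
      ≤⟨ ℤ.+-monoˡ-≤ (+ 2) (ℤ.+-monoˡ-≤ (ℤ.- height c (j ∸ 1)) (height-c≥ j ≤-refl (m<n⇒m≤n∸1 j<i))) ⟩
    height c j ℤ.- height c (j ∸ 1) ℤ.+ + 2
      ≡⟨ cong (λ h → h ℤ.- height c (j ∸ 1) ℤ.+ + 2) (height-pred c j 1≤j) ⟩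
    height c (j ∸ 1) ℤ.+ step c j ℤ.- height c (j ∸ 1) ℤ.+ + 2
      ≡⟨ cancel (height c (j ∸ 1)) (+ cv c j) ⟩
    + cv c j ∎)
    where
    open ℤ.≤-Reasoning
    cancel : ∀ (h x : ℤ) → h ℤ.+ (x ℤ.- + 2) ℤ.- h ℤ.+ + 2 ≡ x
    cancel = solve-∀

  1<c′-j+1 : 1 < cv c′ (suc j)
  1<c′-j+1 = subst (1 <_) (sym c′-at-j+1) (subst (_≤ cv c j ∸ α) (m+n∸m≡n α 2) (∸-monoˡ-≤ α α+2≤c-j))

  1<c′-j : 1 < cv c′ j
  1<c′-j = subst (1 <_) (sym (trans c′-at-j (+-comm α 1))) (s≤s 1≤α)

  height-c′-below : ∀ t → t < j → height c′ t ≡ height c t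
  height-c′-below t t<j = trans (height-shift c c′ 0 0 (+ 0) t refl λ s _ s≤t → c′-below s (≤-<-trans s≤t t<j))
                                (ℤ.+-identityʳ (height c t))

  height-c′-at-j : height c′ j ≡ height c (i ∸ 1) ℤ.- + 1
  height-c′-at-j = begin
    height c′ j
      ≡⟨ height-pred c′ j 1≤j ⟩
    height c′ (j ∸ 1) ℤ.+ (+ cv c′ j ℤ.- + 2)
      ≡⟨ cong₂ (λ h x → h ℤ.+ (+ x ℤ.- + 2)) (height-c′-below (j ∸ 1) (n∸1<n 1≤j)) c′-at-j ⟩
    height c (j ∸ 1) ℤ.+ (+ α ℤ.+ + 1 ℤ.- + 2)
      ≡⟨ cong (λ a → height c (j ∸ 1) ℤ.+ (a ℤ.+ + 1 ℤ.- + 2)) +α ⟩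
    height c (j ∸ 1) ℤ.+ ((height c (i ∸ 1) ℤ.- height c (j ∸ 1)) ℤ.+ + 1 ℤ.- + 2)
      ≡⟨ cancel (height c (j ∸ 1)) (height c (i ∸ 1)) ⟩
    height c (i ∸ 1) ℤ.- + 1 ∎
    where
    open ≡-Reasoning
    cancel : ∀ (p q : ℤ) → p ℤ.+ ((q ℤ.- p) ℤ.+ + 1 ℤ.- + 2) ≡ q ℤ.- + 1
    cancel = solve-∀

  height-c′-at-j+1 : height c′ (suc j) ≡ height c j ℤ.- + 1
  height-c′-at-j+1 = begin
    height c′ j ℤ.+ (+ cv c′ (suc j) ℤ.- + 2)
      ≡⟨ cong₂ (λ h x → h ℤ.+ (+ x ℤ.- + 2)) height-c′-at-j c′-at-j+1 ⟩
    height c (i ∸ 1) ℤ.- + 1 ℤ.+ (+ (cv c j ∸ α) ℤ.- + 2)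
      ≡⟨ cong (λ x → height c (i ∸ 1) ℤ.- + 1 ℤ.+ (x ℤ.- + 2)) (+[m∸n]≡+m-+n (≤-trans (m≤m+n α 2) α+2≤c-j)) ⟩
    height c (i ∸ 1) ℤ.- + 1 ℤ.+ (+ cv c j ℤ.- + α ℤ.- + 2)
      ≡⟨ cong (λ a → height c (i ∸ 1) ℤ.- + 1 ℤ.+ (+ cv c j ℤ.- a ℤ.- + 2)) +α ⟩
    height c (i ∸ 1) ℤ.- + 1 ℤ.+ (+ cv c j ℤ.- (height c (i ∸ 1) ℤ.- height c (j ∸ 1)) ℤ.- + 2)
      ≡⟨ cancel (height c (i ∸ 1)) (height c (j ∸ 1)) (+ cv c j) ⟩
    height c (j ∸ 1) ℤ.+ step c j ℤ.- + 1
      ≡⟨ cong (ℤ._- + 1) (height-pred c j 1≤j) ⟨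
    height c j ℤ.- + 1 ∎
    where
    open ≡-Reasoning
    cancel : ∀ (p q x : ℤ) → p ℤ.- + 1 ℤ.+ (x ℤ.- (p ℤ.- q) ℤ.- + 2) ≡ q ℤ.+ (x ℤ.- + 2) ℤ.- + 1
    cancel = solve-∀

  height-c′-inside : ∀ t → j < t → t ≤ i → height c′ t ≡ height c (t ∸ 1) ℤ.- + 1
  height-c′-inside t j<t t≤i = subst (λ z → height c′ z ≡ height c (z ∸ 1) ℤ.- + 1) (m+[n∸m]≡n j<t)
    (height-shift c c′ (suc j) j (ℤ.- + 1) (t ∸ suc j) height-c′-at-j+1
      λ s 1≤s s≤t-j-1 → c′-inside (suc j + s) (m<m+n (suc j) 1≤s)
        (≤-trans (+-monoʳ-≤ (suc j) s≤t-j-1) (subst (_≤ i) (sym (m+[n∸m]≡n j<t)) t≤i)))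

  height-c′-from-i : ∀ t → i ≤ t → height c′ t ≡ height c t
  height-c′-from-i t i≤t = subst (λ z → height c′ z ≡ height c z) (m+[n∸m]≡n i≤t)
    (trans (height-shift c c′ i i (+ 0) (t ∸ i)
              (trans (trans (height-c′-inside i j<i ≤-refl) (sym height-c-at-i)) (sym (ℤ.+-identityʳ (height c i))))
              λ s 1≤s _ → c′-above (i + s) (m<m+n i 1≤s))
           (ℤ.+-identityʳ _))

  private
    0<height-c-i : + 0 ℤ.< height c (i ∸ 1) ℤ.- + 1
    0<height-c-i = subst (+ 0 ℤ.<_) height-c-at-i (DComp⇒0<height dc i 1≤i i≤n)

  0<height-c′ : ∀ t → 1 ≤ t → t ≤ n → + 0 ℤ.< height c′ t
  0<height-c′ t 1≤t t≤n with <-cmp t j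
  ... | tri< t<j _ _  = subst (+ 0 ℤ.<_) (sym (height-c′-below t t<j)) (DComp⇒0<height dc t 1≤t t≤n)
  ... | tri≈ _ refl _ = subst (+ 0 ℤ.<_) (sym height-c′-at-j) 0<height-c-i
  ... | tri> _ _ j<t with t ≤? i
  ...   | yes t≤i = subst (+ 0 ℤ.<_) (sym (height-c′-inside t j<t t≤i))
    (ℤ.<-≤-trans 0<height-c-i (ℤ.+-monoˡ-≤ (ℤ.- + 1) (height-c≥ (t ∸ 1) (m<n⇒m≤n∸1 j<t) (∸-monoˡ-≤ 1 t≤i))))
  ...   | no  t≰i = subst (+ 0 ℤ.<_) (sym (height-c′-from-i t (<⇒≤ (≰⇒> t≰i)))) (DComp⇒0<height dc t 1≤t t≤n)

  1≤c′ : ∀ t → 1 ≤ t → t ≤ n → 1 ≤ cv c′ t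
  1≤c′ t 1≤t t≤n with <-cmp t j
  ... | tri< t<j _ _  = subst (1 ≤_) (sym (c′-below t t<j)) (DComp⇒1≤part dc t 1≤t t≤n)
  ... | tri≈ _ refl _ = <⇒≤ 1<c′-j
  ... | tri> _ _ j<t with m≤n⇒m<n∨m≡n j<t
  ...   | inj₂ refl = <⇒≤ 1<c′-j+1
  ...   | inj₁ j+1<t with t ≤? i
  ...     | yes t≤i = subst (1 ≤_) (sym (c′-inside t j+1<t t≤i))
    (DComp⇒1≤part dc (t ∸ 1) (m<n⇒m≤n∸1 (≤-<-trans (s≤s z≤n) j+1<t)) (≤-trans (m∸n≤m t 1) t≤n))
  ...     | no  t≰i = subst (1 ≤_) (sym (c′-above t (≰⇒> t≰i))) (DComp⇒1≤part dc t 1≤t t≤n)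

  -- ψ_a undoes the move: in c′ the part at j is a Dnu part whose anchor point is i.

  IsDnu-c′ : IsDnu c′ j
  IsDnu-c′ = 1<c′-j , 1<c′-j+1

  apDnu-c′ : apDnu c′ j ≡ just i
  apDnu-c′ = firstIn-complete (dnuTest c′ j) (suc j) (n ∸ j) i
    (j<i , s≤s (subst (i ≤_) (sym (m+[n∸m]≡n j≤n)) i≤n) ,
     dnuTest-true c′ (<⇒≤ j<i) level (trans (c′-above (suc i) ≤-refl) (proj₂ isDo)) ,
     λ t j<t t<i → dnuTest-false c′ (<⇒≤ j<t) (no-anchor t j<t t<i))
    where
    level : height c′ i ≡ height c′ j
    level = trans (height-c′-from-i i ≤-refl) (trans height-c-at-i (sym height-c′-at-j))
    -- an earlier anchor t would be a part c_t = 1 with height c t = height c (i ∸ 1) - 1, below the minimum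
    no-anchor : ∀ t → j < t → t < i → height c′ t ≡ height c′ j → cv c′ (suc t) ≢ 1
    no-anchor t j<t t<i level-t one = ℤ.<-irrefl refl (ℤ.<-≤-trans (begin-strict
      height c t                    ≡⟨ height-pred c t (≤-trans (s≤s z≤n) j<t) ⟩
      height c (t ∸ 1) ℤ.+ step c t ≡⟨ cong (λ x → height c (t ∸ 1) ℤ.+ (+ x ℤ.- + 2)) c-t≡1 ⟩
      height c (t ∸ 1) ℤ.- + 1      ≡⟨ height-c′-inside t j<t (<⇒≤ t<i) ⟨
      height c′ t                   ≡⟨ trans level-t height-c′-at-j ⟩
      height c (i ∸ 1) ℤ.- + 1      <⟨ x-1<x (height c (i ∸ 1)) ⟩
      height c (i ∸ 1)              ∎) (height-c≥ t (<⇒≤ j<t) (m<n⇒m≤n∸1 t<i)))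
      where
      open ℤ.≤-Reasoning
      c-t≡1 : cv c t ≡ 1
      c-t≡1 = trans (sym (c′-inside (suc t) (s≤s j<t) t<i)) one

  private
    module Back = StepDnu c′ l′ j i 1≤j j<i i≤n

    back-parts : ∀ t → 1 ≤ t → t ≤ n → cv Back.c′ t ≡ cv c t
    back-parts t _ _ with <-cmp t j
    ... | tri< t<j _ _  = trans (Back.c′-below t t<j) (c′-below t t<j)
    ... | tri≈ _ refl _ = trans Back.c′-at-i (trans (cong₂ (λ x y → x + y ∸ 1) c′-at-j c′-at-j+1)
                                                    (α+1+[x∸α]∸1≡x (≤-trans (m≤m+n α 2) α+2≤c-j)))
      where
      α+1+[x∸α]∸1≡x : ∀ {x} → α ≤ x → α + 1 + (x ∸ α) ∸ 1 ≡ x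
      α+1+[x∸α]∸1≡x {x} α≤x = trans (cong (λ k → k + (x ∸ α) ∸ 1) (+-comm α 1)) (m+[n∸m]≡n α≤x)
    ... | tri> _ _ j<t with <-cmp t i
    ...   | tri< t<i _ _  = trans (Back.c′-inside t j<t t<i) (c′-inside (suc t) (s≤s j<t) t<i)
    ...   | tri≈ _ refl _ = trans Back.c′-at-j (sym (proj₁ isDo))
    ...   | tri> _ _ i<t  = trans (Back.c′-above t i<t) (c′-above t i<t)

    back-labels : ∀ t → 1 ≤ t → t ≤ n → lv Back.l′ t ≡ lv l t
    back-labels t _ _ with <-cmp t j
    ... | tri< t<j _ _  = trans (Back.l′-below t t<j) (l′-below t t<j)
    ... | tri≈ _ refl _ = trans (Back.l′-inside t ≤-refl j<i) (l′-inside (suc t) ≤-refl j<i)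
    ... | tri> _ _ j<t with <-cmp t i
    ...   | tri< t<i _ _  = trans (Back.l′-inside t (<⇒≤ j<t) t<i) (l′-inside (suc t) (s≤s (<⇒≤ j<t)) t<i)
    ...   | tri≈ _ refl _ = trans Back.l′-at-j l′-at-j
    ...   | tri> _ _ i<t  = trans (Back.l′-above t i<t) (l′-above t i<t)

  stepDnu-c′ : stepDnu c′ l′ j i ≡ (c , l)
  stepDnu-c′ = cong₂ _,_ (at-ext 1 Back.c′ c back-parts) (at-ext 0 Back.l′ l back-labels)

  -- the counting facts follow from those of the inverse move

  private
    sumMap-c : ∀ h → sumMap h c + (h (cv c′ j) + h (cv c′ (suc j))) ≡ sumMap h c′ + (h Back.merged + h 1)
    sumMap-c h = subst (λ v → sumMap h v + (h (cv c′ j) + h (cv c′ (suc j))) ≡ sumMap h c′ + (h Back.merged + h 1))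
                        (cong proj₁ stepDnu-c′) (Back.sumMap-c′ h)

  sum-c′ : Vec.sum c′ ≡ Vec.sum c
  sum-c′ = begin
    Vec.sum c′    ≡⟨ sum≡sumMap-id c′ ⟩
    sumMap id c′  ≡⟨ +-cancelʳ-≡ (cv c′ j + cv c′ (suc j)) _ _ (trans (cong (λ k → sumMap id c′ + k) (sym merged+1)) (sym (sumMap-c id))) ⟩
    sumMap id c   ≡⟨ sum≡sumMap-id c ⟨
    Vec.sum c     ∎
    where
    open ≡-Reasoning
    merged+1 : Back.merged + 1 ≡ cv c′ j + cv c′ (suc j)
    merged+1 = m∸n+n≡m (≤-trans (<⇒≤ 1<c′-j+1) (m≤n+m _ (cv c′ j)))

  DComp-c′ : DComp n c′
  DComp-c′ = (at⇒All 1 c′ 1≤c′ , trans sum-c′ (proj₂ (proj₁ dc))) ,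
             λ t 1≤t t≤n → subst (+ 0 ℤ.<_) (sym (f-from-1≡height c′ t)) (0<height-c′ t 1≤t t≤n)

  numBig-c′ : numBig c′ ≡ numBig c + 1
  numBig-c′ = +-cancelʳ-≡ 1 _ _ (begin
    numBig c′ + 1
      ≡⟨ cong₂ (λ k b → k + (b + 0)) (numBig≡sumMap-big c′) (sym (big-1< (1<m+n∸1 1<c′-j (<⇒≤ 1<c′-j+1)))) ⟩
    sumMap big c′ + (big Back.merged + big 1)
      ≡⟨ sumMap-c big ⟨
    sumMap big c + (big (cv c′ j) + big (cv c′ (suc j)))
      ≡⟨ cong₂ _+_ (sym (numBig≡sumMap-big c)) (cong₂ _+_ (big-1< 1<c′-j) (big-1< 1<c′-j+1)) ⟩
    numBig c + (1 + 1)
      ≡⟨ +-assoc (numBig c) 1 1 ⟨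
    numBig c + 1 + 1 ∎)
    where open ≡-Reasoning

  IsPerm-l′ : IsPerm n l → IsPerm n l′
  IsPerm-l′ = ↭-trans (↭-sym (subst (λ v → toList v ↭ toList l′) (cong proj₂ stepDnu-c′) Back.l′-↭))

apDnu-just : {c : Vec ℕ n} → DComp n c → ∀ {i} → 1 ≤ i → IsDnu c i → ∃ λ j → apDnu c i ≡ just j
apDnu-just {n} {c} dc {i} 1≤i (_ , 1<c-i+1) with apDnu c i in anchor
... | just j  = j , refl
... | nothing with suc i ≤? n
...   | no  i+1≰n = ⊥-elim (<-irrefl refl (subst (1 <_) (at-beyond 1 c (suc i) (≰⇒> i+1≰n)) 1<c-i+1))
...   | yes i<n   = ⊥-elim (dnuTest-false⇒ c (<⇒≤ i<n) (no-anchor n i<n ≤-refl) height-n≡height-i (at-beyond 1 c (suc n) ≤-refl))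
  where
  no-anchor : ∀ t → suc i ≤ t → t ≤ n → dnuTest c i t ≡ false
  no-anchor t i<t t≤n = firstIn-nothing _ (suc i) (n ∸ i) anchor t i<t
    (subst (t <_) (cong suc (sym (m+[n∸m]≡n (<⇒≤ i<n)))) (s≤s t≤n))
  -- the heights after i stay at or above height c i ≥ 1, but end at height c n = 1
  height-n≡height-i : height c n ≡ height c i
  height-n≡height-i = ℤ.≤-antisym
    (subst (ℤ._≤ height c i) (sym (DComp⇒height-last≡1 dc)) (ℤ.i<j⇒suc[i]≤j (DComp⇒0<height dc i 1≤i (<⇒≤ i<n))))
    (height≥-until-anchor c (DComp⇒1≤part dc) i 1<c-i+1 n ≤-refl
      (λ t i<t t<n → dnuTest-false⇒ c (<⇒≤ i<t) (no-anchor t i<t (<⇒≤ t<n))) n i<n ≤-refl)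

apDo-just : {c : Vec ℕ n} → DComp n c → ∀ {i} → 1 ≤ i → i ≤ n → IsDo c i → ∃ λ j → apDo c i ≡ just j
apDo-just {n} {c} dc {i} 1≤i i≤n _ with apDo c i in anchor
... | just j  = j , refl
apDo-just {n} {c} dc {1} 1≤i i≤n (c-1≡1 , _) | nothing =
  ⊥-elim (0≮-1 (subst (+ 0 ℤ.<_) (cong (λ x → + 0 ℤ.+ (+ x ℤ.- + 2)) c-1≡1) (DComp⇒0<height dc 1 1≤i i≤n)))
  where
  0≮-1 : ¬ (+ 0 ℤ.< - + 1)
  0≮-1 ()
apDo-just {n} {c} dc {suc (suc k)} 1≤i i≤n _ | nothing =
  ⊥-elim (⌊⌋-false⇒¬ (+ 0 ℤ.<? f c 1 (suc k)) (lastIn-nothing _ 1 (suc k) anchor 1 ≤-refl (s≤s (s≤s z≤n)))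
    (proj₂ dc (suc k) (s≤s z≤n) (≤-trans (n≤1+n (suc k)) i≤n)))

IsDnu? : (c : Vec ℕ n) (i : ℕ) → Dec (IsDnu c i)
IsDnu? c i = (1 <? cv c i) ×-dec (1 <? cv c (suc i))

IsDo? : (c : Vec ℕ n) (i : ℕ) → Dec (IsDo c i)
IsDo? c i = (cv c i ≟ 1) ×-dec (cv c (suc i) ≟ 1)

psi-nothing : ∀ {a} {c l : Vec ℕ n} → posOf a l ≡ nothing → psi a (c , l) ≡ (c , l)
psi-nothing {a = a} {l = l} pos with posOf a l | pos
... | nothing | refl = refl

module _ {a i : ℕ} {c l : Vec ℕ n} where

  psi-Dnu : posOf a l ≡ just i → IsDnu c i → ∀ {j} → apDnu c i ≡ just j → psi a (c , l) ≡ stepDnu c l i j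
  psi-Dnu pos (1<c-i , 1<c-i+1) anchor with posOf a l | pos
  ... | just .i | refl = trans (if-T (Equivalence.from T-∧ (<⇒<ᵇ 1<c-i , <⇒<ᵇ 1<c-i+1)))
                               (cong (maybe (stepDnu c l i) (c , l)) anchor)

  psi-Do : posOf a l ≡ just i → IsDo c i → ∀ {j} → apDo c i ≡ just j → psi a (c , l) ≡ stepDo c l i j
  psi-Do pos (c-i≡1 , c-i+1≡1) anchor with posOf a l | pos
  ... | just .i | refl rewrite c-i≡1 | c-i+1≡1 | anchor = refl

  psi-other : posOf a l ≡ just i → ¬ IsDnu c i → ¬ IsDo c i → psi a (c , l) ≡ (c , l)
  psi-other pos ¬dnu ¬do with posOf a l | pos
  ... | just .i | refl = trans (if-¬T (λ t → ¬dnu (Product.map (<ᵇ⇒< 1 _) (<ᵇ⇒< 1 _) (Equivalence.to T-∧ t))))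
                               (if-¬T (λ t → ¬do (Product.map (≡ᵇ⇒≡ _ 1) (≡ᵇ⇒≡ _ 1) (Equivalence.to T-∧ t))))

CountChange : ℕ → Vec ℕ n → Vec ℕ n → Vec ℕ n → Set
CountChange {n} a c l c′ = ∀ (i m : ℕ) → 1 ≤ i → i ≤ n → lv l i ≡ a → numBig c ≡ m →
  (IsDnu c i → numBig c′ ≡ m ∸ 1) × (IsDo c i → numBig c′ ≡ m + 1)

Conclusion : ℕ → Vec ℕ n → Vec ℕ n → Set
Conclusion {n} a c l = DComp n (proj₁ (psi a (c , l))) × IsPerm n (proj₂ (psi a (c , l)))
  × psi a (psi a (c , l)) ≡ (c , l) × CountChange a c l (proj₁ (psi a (c , l)))

conclusion : ∀ {a} {c l c′ l′ : Vec ℕ n} → psi a (c , l) ≡ (c′ , l′) → DComp n c′ → IsPerm n l′ →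
  psi a (c′ , l′) ≡ (c , l) → CountChange a c l c′ → Conclusion a c l
conclusion eq dc′ perm′ back counts rewrite eq = dc′ , perm′ , back , counts

module _ {c l : Vec ℕ n} (dc : DComp n c) (perm : IsPerm n l) {a i : ℕ} (pos : posOf a l ≡ just i) where

  private
    spec : IsPosOf a l i
    spec = posOf-just a l pos
    1≤i : 1 ≤ i
    1≤i = proj₁ spec
    i≤n : i ≤ n
    i≤n = proj₁ (proj₂ spec)
    distinct : LabelsDistinct n l
    distinct = IsPerm⇒LabelsDistinct l perm

    position-unique : ∀ {i′} → 1 ≤ i′ → i′ ≤ n → lv l i′ ≡ a → i′ ≡ i
    position-unique 1≤i′ i′≤n li′≡a = distinct _ i 1≤i′ i′≤n 1≤i i≤n (trans li′≡a (sym (proj₁ (proj₂ (proj₂ spec)))))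

    Dnu⇒¬Do : IsDnu c i → ¬ IsDo c i
    Dnu⇒¬Do dnu isDo = <-irrefl (sym (proj₁ isDo)) (proj₁ dnu)

  conclusion-Dnu : IsDnu c i → Conclusion a c l
  conclusion-Dnu dnu with apDnu-just dc 1≤i dnu
  ... | j , anchor = conclusion (psi-Dnu pos dnu anchor) DComp-c′ (IsPerm-l′ perm)
                       (trans (psi-Do (posOf-l′ distinct spec) IsDo-c′ apDo-c′) stepDo-c′) counts
    where
    open DnuMove dc l 1≤i i≤n dnu anchor
    counts : CountChange a c l c′
    counts i′ _ 1≤i′ i′≤n li′≡a refl with position-unique 1≤i′ i′≤n li′≡a
    ... | refl = (λ _ → trans (sym (m+n∸n≡m (numBig c′) 1)) (cong (_∸ 1) numBig-c′)) ,
                 (⊥-elim ∘ Dnu⇒¬Do dnu)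

  conclusion-Do : IsDo c i → Conclusion a c l
  conclusion-Do isDo with apDo-just dc 1≤i i≤n isDo
  ... | j , anchor = conclusion (psi-Do pos isDo anchor) DComp-c′ (IsPerm-l′ perm)
                       (trans (psi-Dnu (posOf-l′ spec) IsDnu-c′ apDnu-c′) stepDnu-c′) counts
    where
    open DoMove dc l 1≤i i≤n isDo anchor
    counts : CountChange a c l c′
    counts i′ _ 1≤i′ i′≤n li′≡a refl with position-unique 1≤i′ i′≤n li′≡a
    ... | refl = (λ dnu → ⊥-elim (Dnu⇒¬Do dnu isDo)) , (λ _ → numBig-c′)

  conclusion-other : ¬ IsDnu c i → ¬ IsDo c i → Conclusion a c l
  conclusion-other ¬dnu ¬do = conclusion (psi-other pos ¬dnu ¬do) dc perm (psi-other pos ¬dnu ¬do) counts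
    where
    counts : CountChange a c l c
    counts i′ _ 1≤i′ i′≤n li′≡a _ with position-unique 1≤i′ i′≤n li′≡a
    ... | refl = ⊥-elim ∘ ¬dnu , ⊥-elim ∘ ¬do

lemma4p6 : (n : ℕ) → 1 ≤ n → (c l : Vec ℕ n) → DComp n c → IsPerm n l →
    (a : ℕ) → 1 ≤ a → a ≤ n →
      DComp n (proj₁ (psi a (c , l)))
      × IsPerm n (proj₂ (psi a (c , l)))
      × psi a (psi a (c , l)) ≡ (c , l)
      × (∀ (i m : ℕ) → 1 ≤ i → i ≤ n → lv l i ≡ a → numBig c ≡ m →
          (IsDnu c i → numBig (proj₁ (psi a (c , l))) ≡ m ∸ 1)
          × (IsDo c i → numBig (proj₁ (psi a (c , l))) ≡ m + 1))
lemma4p6 n _ c l dc perm a _ _ = by-position (posOf a l) refl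
  where
  by-position : ∀ p → posOf a l ≡ p → Conclusion a c l
  by-position nothing  pos = conclusion (psi-nothing pos) dc perm (psi-nothing pos)
    λ i _ 1≤i i≤n li≡a _ → ⊥-elim (posOf-nothing a l pos i 1≤i i≤n li≡a)
  by-position (just i) pos with IsDnu? c i | IsDo? c i
  ... | yes dnu | _        = conclusion-Dnu dc perm pos dnu
  ... | no  _   | yes isDo = conclusion-Do dc perm pos isDo
  ... | no ¬dnu | no  ¬do  = conclusion-other dc perm pos ¬dnu ¬do
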